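{- For every nonnegative integer $n$, the number of words $w = w_1 w_2 \cdots w_{5n}$ of length $5n$ over the alphabet $\{3,-2\}$ (each letter $w_k \in \{3,-2\}$) such that (i) $\sum_{k=1}^{5n} w_k = 0$, and (ii) there are no indices $1 \le i \le j < 5n$ with $w_i = 3$, $\sum_{k=i}^{j} w_k = 0$, and $w_{j+1} = -2$, is exactly $10^n$.
   Context: A factor of a word is a contiguous subword $w_i w_{i+1}\cdots w_j$. Condition (ii) says: no factor that sums to $0$ and begins with the letter $3$ is immediately followed by the letter $-2$. -}

module Defs where

open import Data.Nat using (ℕ; suc; _≤_; _<_)
open import Data.Integer using (ℤ; +_; -[1+_]; _+_)
open import Data.List using (List; _∷_; length; map; take; drop; foldr)
open import Data.Product using (Σ; _×_)
open import Data.Vec using (Vec; toList)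
open import Data.Refinement using (Refinement)
open import Data.Empty using (⊥)
open import Relation.Binary.PropositionalEquality using (_≡_)

data Letter : Set where
  three    : Letter
  minusTwo : Letter

val : Letter → ℤ
val three    = + 3
val minusTwo = -[1+ 1 ]

Word : Set
Word = List Letter

wsum : Word → ℤ
wsum w = foldr _+_ (+ 0) (map val w)

-- Letter at 0-based position k (positions are 0-based here; the paper's
-- w_{k+1}).
data At : Word → ℕ → Letter → Set where
  here  : ∀ {a w} → At (a ∷ w) 0 a
  there : ∀ {a b w k} → At w k b → At (a ∷ w) (suc k) b

-- Factor w_{i+1} ... w_{j+1} in the paper's 1-based indexing,
-- i.e. 0-based positions i..j inclusive.
factor : ℕ → ℕ → Word → Word
factor i j w = drop i (take (suc j) w)

Bad : Word → Set
Bad w = Σ ℕ λ i → Σ ℕ λ j →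
          (i ≤ j) × (suc j < length w) × At w i three ×
          (wsum (factor i j w) ≡ + 0) × At w (suc j) minusTwo

Good : Word → Set
Good w = (wsum w ≡ + 0) × (Bad w → ⊥)

-- The set of words of length m (w_1 ... w_m as a vector) satisfying (i) and
-- (ii); the proof of goodness is irrelevant, so this is a genuine subset.
GoodWords : ℕ → Set
GoodWords m = Refinement (Vec Letter m) (λ v → Good (toList v))

{-# OPTIONS --safe #-}
-- The height of w after t letters is 5·(number of 3's) - 2t, so the heights at positions in the
-- same residue class modulo 5 (the phase) are congruent modulo 5, and condition (ii) says that no
-- 3 is followed, at the same height, by a -2.  In a good word of length 5(n + 1) let s be the
-- first position whose height is least within its phase class.  Because heights within a class
-- differ by 0 or at least 5, the next four positions are such minima as well and the five letters
-- from s on sum to 0: they are one of the ten balanced words of length 5, read from phase s of the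
-- periodic word c c c …  Removing them leaves a good word of length 5n.  Conversely, given a
-- colour c and a good word w, the block of c is re-inserted at the earliest position minimising
-- the height of w relative to c c c …; the two maps are mutually inverse, which gives 10^n.

module Submission where

open import Defs

open import Data.Nat using (ℕ; zero; suc; pred; >-nonZero; _+_; _*_; _^_; _∸_; _≤_; _<_; z≤n; s≤s; _<?_; _≟_)
import Data.Nat.Properties as ℕₚ
open import Data.Nat.DivMod using (_/_; _%_; m≡m%n+[m/n]*n; m%n<n)
open import Data.Integer using (ℤ; +_; -[1+_]; +≤+; -≤+; -<+)
  renaming (_+_ to _+ᶻ_; _-_ to _-ᶻ_; -_ to -ᶻ_; _*_ to _*ᶻ_; _≤_ to _≤ᶻ_; _<_ to _<ᶻ_)
import Data.Integer.Properties as ℤₚ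
open import Algebra.Properties.AbelianGroup ℤₚ.+-0-abelianGroup using () renaming (∙-cancelˡ to +ᶻ-cancelˡ-≡)
open import Data.Integer.Tactic.RingSolver using (solve-∀)
open import Data.Nat.Tactic.RingSolver using () renaming (solve-∀ to ℕ-solve-∀)
open import Data.Fin using (Fin; zero; suc; toℕ; #_)
import Data.Fin.Properties as Finₚ
open import Data.List using (List; []; _∷_; length; take; drop; _++_)
open import Data.Vec as Vec using (Vec; []; _∷_)
import Data.Vec.Properties as Vecₚ
open import Data.Refinement using (_,_; value-injective)
open import Data.Irrelevant using ([_])
import Data.List.Properties as Listₚ
open import Data.Product using (∃; _×_; _,_; proj₁; proj₂)
open import Data.Sum using (_⊎_; inj₁; inj₂)
open import Data.Empty using (⊥; ⊥-elim)
open import Relation.Nullary using (¬_; Dec; yes; no)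
open import Relation.Nullary.Decidable as Dec using (_→-dec_)
open import Relation.Nullary.Recomputable using (Recomputable; _×-recompute_; ¬-recompute)
open import Relation.Binary.Definitions using (tri<; tri≈; tri>)
open import Relation.Binary.PropositionalEquality
open import Function using (_∘_)
open import Function.Bundles using (_↔_; mk↔ₛ′)
open import Function.Properties.Inverse using (↔-trans; ↔-sym)
open import Data.Product.Function.NonDependent.Propositional using (_×-↔_)

-- Heights and bad pairs

letterAt : Word → ℕ → Letter
letterAt []      _       = three
letterAt (a ∷ w) zero    = a
letterAt (a ∷ w) (suc t) = letterAt w t

height : Word → ℕ → ℤ
height w       zero    = + 0
height []      (suc t) = + 0
height (a ∷ w) (suc t) = val a +ᶻ height w t

height-suc : ∀ w t → t < length w → height w (suc t) ≡ height w t +ᶻ val (letterAt w t)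
height-suc (a ∷ w) zero    _         = ℤₚ.+-comm (val a) (+ 0)
height-suc (a ∷ w) (suc t) (s≤s t<n) = begin
  val a +ᶻ height w (suc t)                            ≡⟨ cong (val a +ᶻ_) (height-suc w t t<n) ⟩
  val a +ᶻ (height w t +ᶻ val (letterAt w t))          ≡⟨ ℤₚ.+-assoc (val a) _ _ ⟨
  val a +ᶻ height w t +ᶻ val (letterAt w t)            ∎
  where open ≡-Reasoning

wsum≡height-length : ∀ w → wsum w ≡ height w (length w)
wsum≡height-length []      = refl
wsum≡height-length (a ∷ w) = cong (val a +ᶻ_) (wsum≡height-length w)

wsum-take : ∀ w m → wsum (take m w) ≡ height w m
wsum-take []      zero    = refl
wsum-take []      (suc m) = refl
wsum-take (a ∷ w) zero    = refl
wsum-take (a ∷ w) (suc m) = cong (val a +ᶻ_) (wsum-take w m)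

height-factor : ∀ w i m → i ≤ m → height w m ≡ height w i +ᶻ wsum (drop i (take m w))
height-factor w       zero    m       _         = trans (sym (wsum-take w m)) (sym (ℤₚ.+-identityˡ _))
height-factor []      (suc i) (suc m) _         = refl
height-factor (a ∷ w) (suc i) (suc m) (s≤s i≤m) =
  trans (cong (val a +ᶻ_) (height-factor w i m i≤m)) (sym (ℤₚ.+-assoc (val a) _ _))

At⇒letterAt : ∀ {w k b} → At w k b → letterAt w k ≡ b
At⇒letterAt here      = refl
At⇒letterAt (there x) = At⇒letterAt x

letterAt⇒At : ∀ w k {b} → k < length w → letterAt w k ≡ b → At w k b
letterAt⇒At (a ∷ w) zero    _         refl = here
letterAt⇒At (a ∷ w) (suc k) (s≤s k<n) eq   = there (letterAt⇒At w k k<n eq)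

-- Condition (ii): the factor w_p … w_(q-1) sums to 0 exactly when the heights at p and q agree.
NoBadPair : Word → Set
NoBadPair w = ∀ p q → p < q → q < length w →
              letterAt w p ≡ three → letterAt w q ≡ minusTwo → height w p ≡ height w q → ⊥

Balanced : Word → Set
Balanced w = height w (length w) ≡ + 0

NoBadPair⇒¬Bad : ∀ w → NoBadPair w → ¬ Bad w
NoBadPair⇒¬Bad w noBad (i , j , i≤j , j+1<n , at-i , factor≡0 , at-j+1) =
  noBad i (suc j) (s≤s i≤j) j+1<n (At⇒letterAt at-i) (At⇒letterAt at-j+1) (begin
    height w i                                     ≡⟨ ℤₚ.+-identityʳ _ ⟨
    height w i +ᶻ + 0                              ≡⟨ cong (height w i +ᶻ_) factor≡0 ⟨
    height w i +ᶻ wsum (factor i j w)              ≡⟨ height-factor w i (suc j) (ℕₚ.m≤n⇒m≤1+n i≤j) ⟨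
    height w (suc j)                               ∎)
  where open ≡-Reasoning

¬Bad⇒NoBadPair : ∀ w → ¬ Bad w → NoBadPair w
¬Bad⇒NoBadPair w ¬bad p (suc j) (s≤s p≤j) j+1<n at-p at-j+1 same =
  ¬bad (p , j , p≤j , j+1<n , letterAt⇒At w p (ℕₚ.<-trans (s≤s p≤j) j+1<n) at-p ,
        factor≡0 , letterAt⇒At w (suc j) j+1<n at-j+1)
  where
  factor≡0 : wsum (factor p j w) ≡ + 0
  factor≡0 = +ᶻ-cancelˡ-≡ (height w p) _ _
               (trans (sym (height-factor w p (suc j) (ℕₚ.m≤n⇒m≤1+n p≤j))) (trans (sym same) (sym (ℤₚ.+-identityʳ (height w p)))))

Good⇒NoBadPair : ∀ w → Good w → NoBadPair w
Good⇒NoBadPair w (_ , ¬bad) = ¬Bad⇒NoBadPair w ¬bad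

Good⇒Balanced : ∀ w → Good w → Balanced w
Good⇒Balanced w (sum≡0 , _) = trans (sym (wsum≡height-length w)) sum≡0

NoBadPair∧Balanced⇒Good : ∀ w → NoBadPair w → Balanced w → Good w
NoBadPair∧Balanced⇒Good w noBad balanced = trans (wsum≡height-length w) balanced , NoBadPair⇒¬Bad w noBad

-- Positions modulo 5

next : Fin 5 → Fin 5
next zero                         = suc zero
next (suc zero)                   = suc (suc zero)
next (suc (suc zero))             = suc (suc (suc zero))
next (suc (suc (suc zero)))       = suc (suc (suc (suc zero)))
next (suc (suc (suc (suc zero)))) = zero

next⁵≡id : ∀ r → next (next (next (next (next r)))) ≡ r
next⁵≡id zero                         = refl
next⁵≡id (suc zero)                   = refl
next⁵≡id (suc (suc zero))             = refl
next⁵≡id (suc (suc (suc zero)))       = refl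
next⁵≡id (suc (suc (suc (suc zero)))) = refl

next-injective : ∀ {r s} → next r ≡ next s → r ≡ s
next-injective {r} {s} eq =
  trans (sym (next⁵≡id r)) (trans (cong (λ x → next (next (next (next x)))) eq) (next⁵≡id s))

phase : ℕ → Fin 5
phase zero    = zero
phase (suc t) = next (phase t)

phase-+-cong : ∀ m {n n′} → phase n ≡ phase n′ → phase (m + n) ≡ phase (m + n′)
phase-+-cong zero    eq = eq
phase-+-cong (suc m) eq = cong next (phase-+-cong m eq)

phase-+-cancelˡ : ∀ m {n n′} → phase (m + n) ≡ phase (m + n′) → phase n ≡ phase n′
phase-+-cancelˡ zero    eq = eq
phase-+-cancelˡ (suc m) eq = phase-+-cancelˡ m (next-injective eq)

next^ : ℕ → Fin 5 → Fin 5
next^ zero    r = r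
next^ (suc j) r = next (next^ j r)

phase-+-next^ : ∀ s j → phase (s + j) ≡ next^ j (phase s)
phase-+-next^ s zero    = cong phase (ℕₚ.+-identityʳ s)
phase-+-next^ s (suc j) = trans (cong phase (ℕₚ.+-suc s j)) (cong next (phase-+-next^ s j))

phase-5+ : ∀ t → phase (5 + t) ≡ phase t
phase-5+ t = next⁵≡id (phase t)

phase-+5 : ∀ t → phase (t + 5) ≡ phase t
phase-+5 t = trans (cong phase (ℕₚ.+-comm t 5)) (phase-5+ t)

phase-5*+ : ∀ k t → phase (5 * k + t) ≡ phase t
phase-5*+ zero    t = refl
phase-5*+ (suc k) t = begin
  phase (5 * suc k + t)   ≡⟨ cong (λ x → phase (x + t)) (ℕₚ.*-suc 5 k) ⟩
  phase (5 + 5 * k + t)   ≡⟨ cong phase (ℕₚ.+-assoc 5 (5 * k) t) ⟩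
  phase (5 + (5 * k + t)) ≡⟨ phase-5+ (5 * k + t) ⟩
  phase (5 * k + t)       ≡⟨ phase-5*+ k t ⟩
  phase t                 ∎
  where open ≡-Reasoning

phase-5* : ∀ k → phase (5 * k) ≡ zero
phase-5* k = trans (cong phase (sym (ℕₚ.+-identityʳ (5 * k)))) (phase-5*+ k 0)

phase-toℕ : ∀ r → phase (toℕ r) ≡ r
phase-toℕ zero                         = refl
phase-toℕ (suc zero)                   = refl
phase-toℕ (suc (suc zero))             = refl
phase-toℕ (suc (suc (suc zero)))       = refl
phase-toℕ (suc (suc (suc (suc zero)))) = refl

toℕ-phase : ∀ {t} → t < 5 → toℕ (phase t) ≡ t
toℕ-phase {0} _ = refl
toℕ-phase {1} _ = refl
toℕ-phase {2} _ = refl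
toℕ-phase {3} _ = refl
toℕ-phase {4} _ = refl
toℕ-phase {suc (suc (suc (suc (suc _))))} (s≤s (s≤s (s≤s (s≤s (s≤s ())))))

phase-injective-<5 : ∀ {i j} → i < 5 → j < 5 → phase i ≡ phase j → i ≡ j
phase-injective-<5 i<5 j<5 eq = trans (sym (toℕ-phase i<5)) (trans (cong toℕ eq) (toℕ-phase j<5))

window-phase-injective : ∀ s {i j} → i < 5 → j < 5 → phase (s + i) ≡ phase (s + j) → i ≡ j
window-phase-injective s i<5 j<5 eq = phase-injective-<5 i<5 j<5 (phase-+-cancelˡ s eq)

window-phase-cover : ∀ s u → ∃ λ j → j < 5 × phase (s + j) ≡ phase u
window-phase-cover s u = toℕ (phase (4 * s + u)) , Finₚ.toℕ<n (phase (4 * s + u)) , (begin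
  phase (s + toℕ (phase (4 * s + u))) ≡⟨ phase-+-cong s (phase-toℕ (phase (4 * s + u))) ⟩
  phase (s + (4 * s + u))             ≡⟨ cong phase (arith s u) ⟩
  phase (5 * s + u)                   ≡⟨ phase-5*+ s u ⟩
  phase u                             ∎)
  where
  open ≡-Reasoning
  arith : ∀ s u → s + (4 * s + u) ≡ 5 * s + u
  arith s u = sym (ℕₚ.+-assoc s (4 * s) u)

position-decomposition : ∀ t → t ≡ 5 * (t / 5) + toℕ (phase t)
position-decomposition t = trans t≡5q+r (cong (λ r → 5 * (t / 5) + r) (sym toℕ-phase≡r))
  where
  t≡5q+r : t ≡ 5 * (t / 5) + t % 5
  t≡5q+r = trans (m≡m%n+[m/n]*n t 5) (trans (ℕₚ.+-comm (t % 5) _) (cong (_+ t % 5) (ℕₚ.*-comm (t / 5) 5)))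
  toℕ-phase≡r : toℕ (phase t) ≡ t % 5
  toℕ-phase≡r = trans (cong (toℕ ∘ phase) t≡5q+r)
                      (trans (cong toℕ (phase-5*+ (t / 5) (t % 5))) (toℕ-phase (m%n<n t 5)))

-- Heights modulo 5

threes : Word → ℕ → ℕ
threes w              zero    = 0
threes []             (suc t) = 0
threes (three ∷ w)    (suc t) = suc (threes w t)
threes (minusTwo ∷ w) (suc t) = threes w t

height-threes : ∀ w t → t ≤ length w → height w t ≡ + 5 *ᶻ + threes w t -ᶻ + 2 *ᶻ + t
height-threes w              zero    _         = refl
height-threes (three ∷ w)    (suc t) (s≤s t≤n) = trans (cong (+ 3 +ᶻ_) (height-threes w t t≤n)) (lemma (+ threes w t) (+ t))
  where
  lemma : ∀ U x → + 3 +ᶻ (+ 5 *ᶻ U -ᶻ + 2 *ᶻ x) ≡ + 5 *ᶻ (+ 1 +ᶻ U) -ᶻ + 2 *ᶻ (+ 1 +ᶻ x)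
  lemma = solve-∀
height-threes (minusTwo ∷ w) (suc t) (s≤s t≤n) = trans (cong (-[1+ 1 ] +ᶻ_) (height-threes w t t≤n)) (lemma (+ threes w t) (+ t))
  where
  lemma : ∀ U x → -[1+ 1 ] +ᶻ (+ 5 *ᶻ U -ᶻ + 2 *ᶻ x) ≡ + 5 *ᶻ U -ᶻ + 2 *ᶻ (+ 1 +ᶻ x)
  lemma = solve-∀

-- Multiplying 5·U + 2v = 5·U′ + 2u by 3, the inverse of 2 modulo 5, gives v ≡ u (mod 5).
height≡⇒phase≡ : ∀ w u v → u ≤ length w → v ≤ length w → height w u ≡ height w v → phase u ≡ phase v
height≡⇒phase≡ w u v u≤n v≤n same = begin
  phase u                        ≡⟨ phase-5*+ (3 * Uv + u) u ⟨
  phase (5 * (3 * Uv + u) + u)   ≡⟨ cong phase (trans (times3 Uv u) (trans (cong (3 *_) (sym ℕ-eq)) (sym (times3 Uu v)))) ⟩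
  phase (5 * (3 * Uu + v) + v)   ≡⟨ phase-5*+ (3 * Uu + v) v ⟩
  phase v                        ∎
  where
  open ≡-Reasoning
  Uu = threes w u
  Uv = threes w v
  times3 : ∀ a b → 5 * (3 * a + b) + b ≡ 3 * (5 * a + 2 * b)
  times3 = ℕ-solve-∀
  rearrange : ∀ a b c d → a -ᶻ b ≡ c -ᶻ d → a +ᶻ d ≡ c +ᶻ b
  rearrange a b c d eq = begin
    a +ᶻ d               ≡⟨ lemma a b d ⟩
    a -ᶻ b +ᶻ b +ᶻ d     ≡⟨ cong (λ x → x +ᶻ b +ᶻ d) eq ⟩
    c -ᶻ d +ᶻ b +ᶻ d     ≡⟨ lemma′ c d b ⟩
    c +ᶻ b               ∎
    where
    lemma : ∀ a b d → a +ᶻ d ≡ a -ᶻ b +ᶻ b +ᶻ d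
    lemma = solve-∀
    lemma′ : ∀ c d b → c -ᶻ d +ᶻ b +ᶻ d ≡ c +ᶻ b
    lemma′ = solve-∀
  ℕ-eq : 5 * Uu + 2 * v ≡ 5 * Uv + 2 * u
  ℕ-eq = ℤₚ.+-injective (begin
    + (5 * Uu + 2 * v)          ≡⟨ embed 5 Uu 2 v ⟩
    + 5 *ᶻ + Uu +ᶻ + 2 *ᶻ + v    ≡⟨ rearrange (+ 5 *ᶻ + Uu) (+ 2 *ᶻ + u) (+ 5 *ᶻ + Uv) (+ 2 *ᶻ + v) same′ ⟩
    + 5 *ᶻ + Uv +ᶻ + 2 *ᶻ + u    ≡⟨ embed 5 Uv 2 u ⟨
    + (5 * Uv + 2 * u)          ∎)
    where
    same′ = trans (sym (height-threes w u u≤n)) (trans same (height-threes w v v≤n))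
    embed : ∀ a b c d → + (a * b + c * d) ≡ + a *ᶻ + b +ᶻ + c *ᶻ + d
    embed a b c d = trans (ℤₚ.pos-+ (a * b) (c * d)) (cong₂ _+ᶻ_ (ℤₚ.pos-* a b) (ℤₚ.pos-* c d))

phase≡⇒height-congruent : ∀ w u v → u ≤ length w → v ≤ length w → phase u ≡ phase v →
                          ∃ λ m → height w v ≡ height w u +ᶻ + 5 *ᶻ m
phase≡⇒height-congruent w u v u≤n v≤n same-phase = m , (begin
  height w v                                             ≡⟨ height-threes w v v≤n ⟩
  + 5 *ᶻ Uv -ᶻ + 2 *ᶻ + v                                 ≡⟨ cong (λ x → + 5 *ᶻ Uv -ᶻ + 2 *ᶻ x) (decompose v (sym same-phase)) ⟩
  + 5 *ᶻ Uv -ᶻ + 2 *ᶻ (+ 5 *ᶻ qv +ᶻ r)                    ≡⟨ lemma Uu Uv qu qv r ⟩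
  + 5 *ᶻ Uu -ᶻ + 2 *ᶻ (+ 5 *ᶻ qu +ᶻ r) +ᶻ + 5 *ᶻ m        ≡⟨ cong (λ x → + 5 *ᶻ Uu -ᶻ + 2 *ᶻ x +ᶻ + 5 *ᶻ m) (decompose u refl) ⟨
  + 5 *ᶻ Uu -ᶻ + 2 *ᶻ + u +ᶻ + 5 *ᶻ m                     ≡⟨ cong (_+ᶻ + 5 *ᶻ m) (height-threes w u u≤n) ⟨
  height w u +ᶻ + 5 *ᶻ m                                 ∎)
  where
  open ≡-Reasoning
  Uu = + threes w u
  Uv = + threes w v
  qu = + (u / 5)
  qv = + (v / 5)
  r  = + toℕ (phase u)
  m  = (Uv -ᶻ Uu) -ᶻ + 2 *ᶻ (qv -ᶻ qu)
  decompose : ∀ t → phase t ≡ phase u → + t ≡ + 5 *ᶻ + (t / 5) +ᶻ r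
  decompose t same = begin
    + t                                    ≡⟨ cong +_ (position-decomposition t) ⟩
    + (5 * (t / 5) + toℕ (phase t))        ≡⟨ ℤₚ.pos-+ (5 * (t / 5)) _ ⟩
    + (5 * (t / 5)) +ᶻ + toℕ (phase t)      ≡⟨ cong₂ _+ᶻ_ (ℤₚ.pos-* 5 (t / 5)) (cong (+_ ∘ toℕ) same) ⟩
    + 5 *ᶻ + (t / 5) +ᶻ r                   ∎
  lemma : ∀ Uu Uv qu qv r → + 5 *ᶻ Uv -ᶻ + 2 *ᶻ (+ 5 *ᶻ qv +ᶻ r) ≡
          + 5 *ᶻ Uu -ᶻ + 2 *ᶻ (+ 5 *ᶻ qu +ᶻ r) +ᶻ + 5 *ᶻ ((Uv -ᶻ Uu) -ᶻ + 2 *ᶻ (qv -ᶻ qu))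
  lemma = solve-∀

<-+5*⇒+5≤ : ∀ h m → h <ᶻ h +ᶻ + 5 *ᶻ m → h +ᶻ + 5 ≤ᶻ h +ᶻ + 5 *ᶻ m
<-+5*⇒+5≤ h (+ zero)  h<h = ⊥-elim (ℤₚ.<-irrefl (sym (trans (cong (h +ᶻ_) (ℤₚ.*-zeroʳ (+ 5))) (ℤₚ.+-identityʳ h))) h<h)
<-+5*⇒+5≤ h (+ suc k) _   = ℤₚ.+-monoʳ-≤ h (ℤₚ.≤-trans (+≤+ (ℕₚ.m≤m+n 5 (5 * k)))
                                 (ℤₚ.≤-reflexive (trans (cong +_ (sym (ℕₚ.*-suc 5 k))) (ℤₚ.pos-* 5 (suc k)))))
<-+5*⇒+5≤ h -[1+ k ]  h<h = ⊥-elim (ℤₚ.<-asym h<h (ℤₚ.<-≤-trans (ℤₚ.+-monoʳ-< h -<+) (ℤₚ.≤-reflexive (ℤₚ.+-identityʳ h))))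

height-gap : ∀ w u v → u ≤ length w → v ≤ length w → phase u ≡ phase v →
             height w u <ᶻ height w v → height w u +ᶻ + 5 ≤ᶻ height w v
height-gap w u v u≤n v≤n same-phase u<v =
  let m , v≡u+5m = phase≡⇒height-congruent w u v u≤n v≤n same-phase in
  subst (height w u +ᶻ + 5 ≤ᶻ_) (sym v≡u+5m) (<-+5*⇒+5≤ (height w u) m (subst (height w u <ᶻ_) v≡u+5m u<v))

-- Splicing a window of five letters

letterAt-++ˡ : ∀ xs ys t → t < length xs → letterAt (xs ++ ys) t ≡ letterAt xs t
letterAt-++ˡ (x ∷ xs) ys zero    _         = refl
letterAt-++ˡ (x ∷ xs) ys (suc t) (s≤s t<n) = letterAt-++ˡ xs ys t t<n

letterAt-++ʳ : ∀ xs ys j → letterAt (xs ++ ys) (length xs + j) ≡ letterAt ys j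
letterAt-++ʳ []       ys j = refl
letterAt-++ʳ (x ∷ xs) ys j = letterAt-++ʳ xs ys j

height-++ˡ : ∀ xs ys t → t ≤ length xs → height (xs ++ ys) t ≡ height xs t
height-++ˡ xs       ys zero    _         = refl
height-++ˡ (x ∷ xs) ys (suc t) (s≤s t≤n) = cong (val x +ᶻ_) (height-++ˡ xs ys t t≤n)

height-++ʳ : ∀ xs ys j → height (xs ++ ys) (length xs + j) ≡ height xs (length xs) +ᶻ height ys j
height-++ʳ []       ys j = sym (ℤₚ.+-identityˡ _)
height-++ʳ (x ∷ xs) ys j = trans (cong (val x +ᶻ_) (height-++ʳ xs ys j)) (sym (ℤₚ.+-assoc (val x) _ _))

length-take≤ : ∀ s (w : Word) → s ≤ length w → length (take s w) ≡ s
length-take≤ s w s≤n = trans (Listₚ.length-take s w) (ℕₚ.m≤n⇒m⊓n≡m s≤n)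

letterAt-take : ∀ s w t → t < s → letterAt (take s w) t ≡ letterAt w t
letterAt-take (suc s) []      t       _         = refl
letterAt-take (suc s) (a ∷ w) zero    _         = refl
letterAt-take (suc s) (a ∷ w) (suc t) (s≤s t<s) = letterAt-take s w t t<s

height-take : ∀ s w t → t ≤ s → height (take s w) t ≡ height w t
height-take s       w       zero    _         = refl
height-take (suc s) []      (suc t) _         = refl
height-take (suc s) (a ∷ w) (suc t) (s≤s t≤s) = cong (val a +ᶻ_) (height-take s w t t≤s)

letterAt-drop : ∀ s w k → letterAt (drop s w) k ≡ letterAt w (s + k)
letterAt-drop zero    w       k = refl
letterAt-drop (suc s) []      k = refl
letterAt-drop (suc s) (a ∷ w) k = letterAt-drop s w k

height-drop : ∀ s w k → s ≤ length w → height w (s + k) ≡ height w s +ᶻ height (drop s w) k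
height-drop zero    w       k _         = sym (ℤₚ.+-identityˡ _)
height-drop (suc s) (a ∷ w) k (s≤s s≤n) =
  trans (cong (val a +ᶻ_) (height-drop s w k s≤n)) (sym (ℤₚ.+-assoc (val a) _ _))

take-++ˡ : ∀ (xs ys : Word) k → take (length xs + k) (xs ++ ys) ≡ xs ++ take k ys
take-++ˡ []       ys k = refl
take-++ˡ (x ∷ xs) ys k = cong (x ∷_) (take-++ˡ xs ys k)

drop-++ˡ : ∀ (xs ys : Word) k → drop (length xs + k) (xs ++ ys) ≡ drop k ys
drop-++ˡ []       ys k = refl
drop-++ˡ (x ∷ xs) ys k = drop-++ˡ xs ys k

take-length-++ : ∀ (xs ys : Word) → take (length xs) (xs ++ ys) ≡ xs
take-length-++ xs ys =
  trans (cong (λ n → take n (xs ++ ys)) (sym (ℕₚ.+-identityʳ (length xs)))) (trans (take-++ˡ xs ys 0) (Listₚ.++-identityʳ xs))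

drop-length-++ : ∀ (xs ys : Word) → drop (length xs) (xs ++ ys) ≡ ys
drop-length-++ xs ys = trans (cong (λ n → drop n (xs ++ ys)) (sym (ℕₚ.+-identityʳ (length xs)))) (drop-++ˡ xs ys 0)

insertAt : ℕ → Word → Word → Word
insertAt s b w = take s w ++ (b ++ drop s w)

removeWindowAt : ℕ → Word → Word
removeWindowAt s w = take s w ++ drop (5 + s) w

windowAt : ℕ → Word → Word
windowAt s w = take 5 (drop s w)

length-insertAt : ∀ s b w → s ≤ length w → length b ≡ 5 → length (insertAt s b w) ≡ 5 + length w
length-insertAt s b w s≤n |b|≡5 = begin
  length (take s w ++ (b ++ drop s w))   ≡⟨ Listₚ.length-++ (take s w) ⟩
  length (take s w) + length (b ++ drop s w)
    ≡⟨ cong₂ _+_ (length-take≤ s w s≤n) (trans (Listₚ.length-++ b) (cong₂ _+_ |b|≡5 (Listₚ.length-drop s w))) ⟩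
  s + (5 + (length w ∸ s))               ≡⟨ ℕₚ.+-assoc s 5 _ ⟨
  s + 5 + (length w ∸ s)                 ≡⟨ cong (_+ (length w ∸ s)) (ℕₚ.+-comm s 5) ⟩
  5 + s + (length w ∸ s)                 ≡⟨ ℕₚ.+-assoc 5 s _ ⟩
  5 + (s + (length w ∸ s))               ≡⟨ cong (λ n → 5 + n) (ℕₚ.m+[n∸m]≡n s≤n) ⟩
  5 + length w                           ∎
  where open ≡-Reasoning

removeWindowAt-insertAt : ∀ s b w → s ≤ length w → length b ≡ 5 → removeWindowAt s (insertAt s b w) ≡ w
removeWindowAt-insertAt s b w s≤n |b|≡5 = trans (cong₂ _++_ prefix suffix) (Listₚ.take++drop≡id s w)
  where
  xs = take s w
  |xs|≡s = length-take≤ s w s≤n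
  prefix : take s (xs ++ (b ++ drop s w)) ≡ xs
  prefix = trans (cong (λ n → take n (xs ++ (b ++ drop s w))) (sym |xs|≡s)) (take-length-++ xs _)
  suffix : drop (5 + s) (xs ++ (b ++ drop s w)) ≡ drop s w
  suffix = begin
    drop (5 + s) (xs ++ (b ++ drop s w))           ≡⟨ cong (λ n → drop n (xs ++ (b ++ drop s w))) (trans (ℕₚ.+-comm 5 s) (cong (_+ 5) (sym |xs|≡s))) ⟩
    drop (length xs + 5) (xs ++ (b ++ drop s w))   ≡⟨ drop-++ˡ xs _ 5 ⟩
    drop 5 (b ++ drop s w)                         ≡⟨ cong (λ n → drop n (b ++ drop s w)) (sym |b|≡5) ⟩
    drop (length b) (b ++ drop s w)                ≡⟨ drop-length-++ b _ ⟩
    drop s w                                       ∎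
    where open ≡-Reasoning

insertAt-removeWindowAt : ∀ s w → s ≤ length w → insertAt s (windowAt s w) (removeWindowAt s w) ≡ w
insertAt-removeWindowAt s w s≤n = begin
  take s (xs ++ ys) ++ (windowAt s w ++ drop s (xs ++ ys))
    ≡⟨ cong₂ (λ p q → p ++ (windowAt s w ++ q)) prefix suffix ⟩
  xs ++ (take 5 (drop s w) ++ drop 5 (drop s w))
    ≡⟨ cong (xs ++_) (Listₚ.take++drop≡id 5 (drop s w)) ⟩
  xs ++ drop s w
    ≡⟨ Listₚ.take++drop≡id s w ⟩
  w ∎
  where
  open ≡-Reasoning
  xs = take s w
  ys = drop (5 + s) w
  |xs|≡s = length-take≤ s w s≤n
  prefix : take s (xs ++ ys) ≡ xs
  prefix = trans (cong (λ n → take n (xs ++ ys)) (sym |xs|≡s)) (take-length-++ xs ys)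
  suffix : drop s (xs ++ ys) ≡ drop 5 (drop s w)
  suffix = trans (cong (λ n → drop n (xs ++ ys)) (sym |xs|≡s))
                 (trans (drop-length-++ xs ys) (trans (cong (λ n → drop n w) (ℕₚ.+-comm 5 s)) (sym (Listₚ.drop-drop s 5 w))))

windowAt-insertAt : ∀ s b w → s ≤ length w → length b ≡ 5 → windowAt s (insertAt s b w) ≡ b
windowAt-insertAt s b w s≤n |b|≡5 = begin
  take 5 (drop s (xs ++ (b ++ drop s w)))   ≡⟨ cong (λ n → take 5 (drop n (xs ++ (b ++ drop s w)))) (sym (length-take≤ s w s≤n)) ⟩
  take 5 (drop (length xs) (xs ++ (b ++ drop s w))) ≡⟨ cong (take 5) (drop-length-++ xs _) ⟩
  take 5 (b ++ drop s w)                    ≡⟨ cong (λ n → take n (b ++ drop s w)) (sym |b|≡5) ⟩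
  take (length b) (b ++ drop s w)           ≡⟨ take-length-++ b _ ⟩
  b                                         ∎
  where
  open ≡-Reasoning
  xs = take s w

data Position (s : ℕ) : ℕ → Set where
  before : ∀ {u} → u < s → Position s u
  after  : ∀ k → Position s (s + k)

position : ∀ s u → Position s u
position s u with u <? s
... | yes u<s = before u<s
... | no  u≮s = subst (Position s) (ℕₚ.m+[n∸m]≡n (ℕₚ.≮⇒≥ u≮s)) (after (u ∸ s))

shift : ℕ → ℕ → ℕ
shift s u with u <? s
... | yes _ = u
... | no  _ = 5 + u

shift-< : ∀ {s u} → u < s → shift s u ≡ u
shift-< {s} {u} u<s with u <? s
... | yes _   = refl
... | no  u≮s = ⊥-elim (u≮s u<s)

shift-≥ : ∀ {s u} → s ≤ u → shift s u ≡ 5 + u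
shift-≥ {s} {u} s≤u with u <? s
... | yes u<s = ⊥-elim (ℕₚ.<-irrefl refl (ℕₚ.<-≤-trans u<s s≤u))
... | no  _   = refl

+-middle-5 : ∀ s k → 5 + (s + k) ≡ s + (5 + k)
+-middle-5 s k = trans (sym (ℕₚ.+-assoc 5 s k)) (trans (cong (_+ k) (ℕₚ.+-comm 5 s)) (ℕₚ.+-assoc s 5 k))

shift-+ : ∀ s k → shift s (s + k) ≡ s + (5 + k)
shift-+ s k = trans (shift-≥ (ℕₚ.m≤m+n s k)) (+-middle-5 s k)

phase-shift : ∀ s u → phase (shift s u) ≡ phase u
phase-shift s u with u <? s
... | yes _ = refl
... | no  _ = phase-5+ u

shift-monotone : ∀ s {u v} → u < v → shift s u < shift s v
shift-monotone s {u} {v} u<v with u <? s | v <? s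
... | yes _   | yes _   = u<v
... | yes _   | no  _   = ℕₚ.<-trans u<v (ℕₚ.m<n+m v {5} (s≤s z≤n))
... | no  u≮s | yes v<s = ⊥-elim (u≮s (ℕₚ.<-trans u<v v<s))
... | no  _   | no  _   = ℕₚ.+-monoʳ-< 5 u<v

shift-cancel-< : ∀ s {u v} → shift s u < shift s v → u < v
shift-cancel-< s {u} {v} su<sv with ℕₚ.<-cmp u v
... | tri< u<v _ _ = u<v
... | tri≈ _ refl _ = ⊥-elim (ℕₚ.<-irrefl refl su<sv)
... | tri> _ _ v<u = ⊥-elim (ℕₚ.<-asym su<sv (shift-monotone s v<u))

module Splice (s : ℕ) (b w : Word) (s≤n : s ≤ length w) (|b|≡5 : length b ≡ 5) where

  w′ : Word
  w′ = insertAt s b w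

  private
    xs = take s w
    |xs|≡s : length xs ≡ s
    |xs|≡s = length-take≤ s w s≤n

    letterAt-rest : ∀ j → letterAt w′ (s + j) ≡ letterAt (b ++ drop s w) j
    letterAt-rest j = subst (λ n → letterAt w′ (n + j) ≡ letterAt (b ++ drop s w) j) |xs|≡s (letterAt-++ʳ xs _ j)

    height-rest : ∀ j → height w′ (s + j) ≡ height w s +ᶻ height (b ++ drop s w) j
    height-rest j = trans (subst (λ n → height w′ (n + j) ≡ height xs (length xs) +ᶻ height (b ++ drop s w) j) |xs|≡s (height-++ʳ xs _ j))
                          (cong (_+ᶻ height (b ++ drop s w) j) (trans (cong (height xs) |xs|≡s) (height-take s w s ℕₚ.≤-refl)))

  length-w′ : length w′ ≡ 5 + length w
  length-w′ = length-insertAt s b w s≤n |b|≡5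

  letterAt-before : ∀ t → t < s → letterAt w′ t ≡ letterAt w t
  letterAt-before t t<s = trans (letterAt-++ˡ xs _ t (subst (t <_) (sym |xs|≡s) t<s)) (letterAt-take s w t t<s)

  height-before : ∀ t → t ≤ s → height w′ t ≡ height w t
  height-before t t≤s = trans (height-++ˡ xs _ t (subst (t ≤_) (sym |xs|≡s) t≤s)) (height-take s w t t≤s)

  letterAt-window : ∀ j → j < 5 → letterAt w′ (s + j) ≡ letterAt b j
  letterAt-window j j<5 = trans (letterAt-rest j) (letterAt-++ˡ b _ j (subst (j <_) (sym |b|≡5) j<5))

  height-window : ∀ j → j ≤ 5 → height w′ (s + j) ≡ height w s +ᶻ height b j
  height-window j j≤5 = trans (height-rest j) (cong (height w s +ᶻ_) (height-++ˡ b _ j (subst (j ≤_) (sym |b|≡5) j≤5)))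

  letterAt-after : ∀ k → letterAt w′ (s + (5 + k)) ≡ letterAt w (s + k)
  letterAt-after k = begin
    letterAt w′ (s + (5 + k))                 ≡⟨ letterAt-rest (5 + k) ⟩
    letterAt (b ++ drop s w) (5 + k)          ≡⟨ cong (λ n → letterAt (b ++ drop s w) (n + k)) |b|≡5 ⟨
    letterAt (b ++ drop s w) (length b + k)   ≡⟨ letterAt-++ʳ b _ k ⟩
    letterAt (drop s w) k                     ≡⟨ letterAt-drop s w k ⟩
    letterAt w (s + k)                        ∎
    where open ≡-Reasoning

  height-after : Balanced b → ∀ k → height w′ (s + (5 + k)) ≡ height w (s + k)
  height-after b-balanced k = begin
    height w′ (s + (5 + k))                                  ≡⟨ height-rest (5 + k) ⟩
    height w s +ᶻ height (b ++ drop s w) (5 + k)             ≡⟨ cong (λ n → height w s +ᶻ height (b ++ drop s w) (n + k)) |b|≡5 ⟨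
    height w s +ᶻ height (b ++ drop s w) (length b + k)      ≡⟨ cong (height w s +ᶻ_) (height-++ʳ b _ k) ⟩
    height w s +ᶻ (height b (length b) +ᶻ height (drop s w) k) ≡⟨ cong (λ h → height w s +ᶻ (h +ᶻ height (drop s w) k)) b-balanced ⟩
    height w s +ᶻ (+ 0 +ᶻ height (drop s w) k)                ≡⟨ cong (height w s +ᶻ_) (ℤₚ.+-identityˡ _) ⟩
    height w s +ᶻ height (drop s w) k                        ≡⟨ height-drop s w k s≤n ⟨
    height w (s + k)                                         ∎
    where open ≡-Reasoning

  letterAt-shift : ∀ u → letterAt w′ (shift s u) ≡ letterAt w u
  letterAt-shift u with position s u
  ... | before u<s = trans (cong (letterAt w′) (shift-< u<s)) (letterAt-before u u<s)
  ... | after k    = trans (cong (letterAt w′) (shift-+ s k)) (letterAt-after k)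

  height-shift : Balanced b → ∀ u → height w′ (shift s u) ≡ height w u
  height-shift b-balanced u with position s u
  ... | before u<s = trans (cong (height w′) (shift-< u<s)) (height-before u (ℕₚ.<⇒≤ u<s))
  ... | after k    = trans (cong (height w′) (shift-+ s k)) (height-after b-balanced k)

  shift-<-length : ∀ u → u < length w → shift s u < length w′
  shift-<-length u u<n = subst (shift s u <_) (sym length-w′) (bound (position s u))
    where
    bound : Position s u → shift s u < 5 + length w
    bound (before u<s) = subst (_< 5 + length w) (sym (shift-< u<s)) (ℕₚ.<-trans u<n (ℕₚ.m<n+m (length w) {5} (s≤s z≤n)))
    bound (after k)    = subst (_< 5 + length w) (sym (trans (shift-+ s k) (sym (+-middle-5 s k)))) (ℕₚ.+-monoʳ-< 5 u<n)

  window-<-length : ∀ j → j < 5 → s + j < length w′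
  window-<-length j j<5 = subst (s + j <_) (sym length-w′)
    (ℕₚ.<-≤-trans (ℕₚ.+-monoʳ-< s j<5) (subst (_≤ 5 + length w) (ℕₚ.+-comm 5 s) (ℕₚ.+-monoʳ-≤ 5 s≤n)))

  old-or-new : ∀ t → t < length w′ → (∃ λ u → u < length w × t ≡ shift s u) ⊎ (∃ λ j → j < 5 × t ≡ s + j)
  old-or-new t t<n′ with position s t
  ... | before t<s = inj₁ (t , ℕₚ.<-≤-trans t<s s≤n , sym (shift-< t<s))
  ... | after k with k <? 5
  ...   | yes k<5 = inj₂ (k , k<5 , refl)
  ...   | no  k≮5 = inj₁ (s + (k ∸ 5) , bound , sym (trans (shift-+ s (k ∸ 5)) (cong (λ n → s + n) k≡5+[k∸5])))
    where
    k≡5+[k∸5] : 5 + (k ∸ 5) ≡ k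
    k≡5+[k∸5] = trans (ℕₚ.+-comm 5 (k ∸ 5)) (ℕₚ.m∸n+n≡m (ℕₚ.≮⇒≥ k≮5))
    bound : s + (k ∸ 5) < length w
    bound = ℕₚ.+-cancelˡ-< 5 _ _ (subst (_< 5 + length w) (trans (cong (λ n → s + n) (sym k≡5+[k∸5])) (sym (+-middle-5 s (k ∸ 5))))
                                  (subst (s + k <_) length-w′ t<n′))

  shift-<-window⇒< : ∀ u j → shift s u < s + j → j < 5 → u < s
  shift-<-window⇒< u j su<s+j j<5 with position s u
  ... | before u<s = u<s
  ... | after k    = ⊥-elim (ℕₚ.<-asym su<s+j (subst (s + j <_) (sym (shift-+ s k)) (ℕₚ.+-monoʳ-< s (ℕₚ.<-≤-trans j<5 (ℕₚ.m≤m+n 5 k)))))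

  NoBadPair-remove : Balanced b → NoBadPair w′ → NoBadPair w
  NoBadPair-remove b-balanced noBad p q p<q q<n at-p at-q same =
    noBad (shift s p) (shift s q) (shift-monotone s p<q) (shift-<-length q q<n)
          (trans (letterAt-shift p) at-p) (trans (letterAt-shift q) at-q)
          (trans (height-shift b-balanced p) (trans same (sym (height-shift b-balanced q))))

-- The ten balanced words of length 5, read periodically

-- c i j is the balanced word of length 5 whose two 3's sit at places i and j.
data Colour : Set where
  c01 c02 c03 c04 c12 c13 c14 c23 c24 c34 : Colour

colourWord : Colour → Vec Letter 5
colourWord c01 = three    ∷ three    ∷ minusTwo ∷ minusTwo ∷ minusTwo ∷ []
colourWord c02 = three    ∷ minusTwo ∷ three    ∷ minusTwo ∷ minusTwo ∷ []
colourWord c03 = three    ∷ minusTwo ∷ minusTwo ∷ three    ∷ minusTwo ∷ []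
colourWord c04 = three    ∷ minusTwo ∷ minusTwo ∷ minusTwo ∷ three    ∷ []
colourWord c12 = minusTwo ∷ three    ∷ three    ∷ minusTwo ∷ minusTwo ∷ []
colourWord c13 = minusTwo ∷ three    ∷ minusTwo ∷ three    ∷ minusTwo ∷ []
colourWord c14 = minusTwo ∷ three    ∷ minusTwo ∷ minusTwo ∷ three    ∷ []
colourWord c23 = minusTwo ∷ minusTwo ∷ three    ∷ three    ∷ minusTwo ∷ []
colourWord c24 = minusTwo ∷ minusTwo ∷ three    ∷ minusTwo ∷ three    ∷ []
colourWord c34 = minusTwo ∷ minusTwo ∷ minusTwo ∷ three    ∷ three    ∷ []

colourLetter : Colour → Fin 5 → Letter
colourLetter c = Vec.lookup (colourWord c)

block : Colour → Fin 5 → Word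
block c r = colourLetter c r ∷ colourLetter c (next r) ∷ colourLetter c (next (next r)) ∷
            colourLetter c (next (next (next r))) ∷ colourLetter c (next (next (next (next r)))) ∷ []

block-balanced : ∀ c → Balanced (block c zero)
block-balanced c01 = refl
block-balanced c02 = refl
block-balanced c03 = refl
block-balanced c04 = refl
block-balanced c12 = refl
block-balanced c13 = refl
block-balanced c14 = refl
block-balanced c23 = refl
block-balanced c24 = refl
block-balanced c34 = refl

prefixHeight : Colour → Fin 5 → ℤ
prefixHeight c r = height (block c zero) (toℕ r)

prefixHeight-next : ∀ c r → prefixHeight c (next r) ≡ prefixHeight c r +ᶻ val (colourLetter c r)
prefixHeight-next c zero                         = height-suc (block c zero) 0 (s≤s z≤n)
prefixHeight-next c (suc zero)                   = height-suc (block c zero) 1 (s≤s (s≤s z≤n))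
prefixHeight-next c (suc (suc zero))             = height-suc (block c zero) 2 (s≤s (s≤s (s≤s z≤n)))
prefixHeight-next c (suc (suc (suc zero)))       = height-suc (block c zero) 3 (s≤s (s≤s (s≤s (s≤s z≤n))))
prefixHeight-next c (suc (suc (suc (suc zero)))) =
  sym (trans (sym (height-suc (block c zero) 4 ℕₚ.≤-refl)) (block-balanced c))

-- The height of the infinite word c c c … after t letters.
periodicHeight : Colour → ℕ → ℤ
periodicHeight c t = prefixHeight c (phase t)

periodicHeight-suc : ∀ c t → periodicHeight c (suc t) ≡ periodicHeight c t +ᶻ val (colourLetter c (phase t))
periodicHeight-suc c t = prefixHeight-next c (phase t)

periodicHeight-phase : ∀ c {u v} → phase u ≡ phase v → periodicHeight c u ≡ periodicHeight c v
periodicHeight-phase c = cong (prefixHeight c)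

letterAt-block : ∀ c r j → j < 5 → letterAt (block c r) j ≡ colourLetter c (next^ j r)
letterAt-block c r 0 _ = refl
letterAt-block c r 1 _ = refl
letterAt-block c r 2 _ = refl
letterAt-block c r 3 _ = refl
letterAt-block c r 4 _ = refl
letterAt-block c r (suc (suc (suc (suc (suc _))))) (s≤s (s≤s (s≤s (s≤s (s≤s ())))))

blockAt : Colour → ℕ → Word
blockAt c s = block c (phase s)

letterAt-blockAt : ∀ c s j → j < 5 → letterAt (blockAt c s) j ≡ colourLetter c (phase (s + j))
letterAt-blockAt c s j j<5 = trans (letterAt-block c (phase s) j j<5) (cong (colourLetter c) (sym (phase-+-next^ s j)))

height-blockAt : ∀ c s j → j ≤ 5 → height (blockAt c s) j ≡ periodicHeight c (s + j) -ᶻ periodicHeight c s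
height-blockAt c s zero    _         = trans (sym (ℤₚ.+-inverseʳ (periodicHeight c s)))
                                             (cong (λ t → periodicHeight c t -ᶻ periodicHeight c s) (sym (ℕₚ.+-identityʳ s)))
height-blockAt c s (suc j) (s≤s j<5) = begin
  height (blockAt c s) (suc j)                                      ≡⟨ height-suc (blockAt c s) j (s≤s j<5) ⟩
  height (blockAt c s) j +ᶻ val (letterAt (blockAt c s) j)          ≡⟨ cong₂ _+ᶻ_ (height-blockAt c s j (ℕₚ.m≤n⇒m≤1+n j<5))
                                                                                (cong val (letterAt-blockAt c s j (s≤s j<5))) ⟩
  P (s + j) -ᶻ P s +ᶻ val (colourLetter c (phase (s + j)))          ≡⟨ swap (P (s + j)) (P s) _ ⟩
  P (s + j) +ᶻ val (colourLetter c (phase (s + j))) -ᶻ P s          ≡⟨ cong (_-ᶻ P s) (periodicHeight-suc c (s + j)) ⟨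
  P (suc (s + j)) -ᶻ P s                                            ≡⟨ cong (λ t → P t -ᶻ P s) (ℕₚ.+-suc s j) ⟨
  P (s + suc j) -ᶻ P s                                              ∎
  where
  open ≡-Reasoning
  P = periodicHeight c
  swap : ∀ a b x → a -ᶻ b +ᶻ x ≡ a +ᶻ x -ᶻ b
  swap = solve-∀

blockAt-balanced : ∀ c s → Balanced (blockAt c s)
blockAt-balanced c s = begin
  height (blockAt c s) 5                              ≡⟨ height-blockAt c s 5 ℕₚ.≤-refl ⟩
  periodicHeight c (s + 5) -ᶻ periodicHeight c s      ≡⟨ cong (_-ᶻ periodicHeight c s) (periodicHeight-phase c {s + 5} {s} (phase-+5 s)) ⟩
  periodicHeight c s -ᶻ periodicHeight c s            ≡⟨ ℤₚ.+-inverseʳ (periodicHeight c s) ⟩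
  + 0                                                 ∎
  where open ≡-Reasoning

classify : Word → Colour
classify (three    ∷ three    ∷ minusTwo ∷ minusTwo ∷ minusTwo ∷ []) = c01
classify (three    ∷ minusTwo ∷ three    ∷ minusTwo ∷ minusTwo ∷ []) = c02
classify (three    ∷ minusTwo ∷ minusTwo ∷ three    ∷ minusTwo ∷ []) = c03
classify (three    ∷ minusTwo ∷ minusTwo ∷ minusTwo ∷ three    ∷ []) = c04
classify (minusTwo ∷ three    ∷ three    ∷ minusTwo ∷ minusTwo ∷ []) = c12
classify (minusTwo ∷ three    ∷ minusTwo ∷ three    ∷ minusTwo ∷ []) = c13
classify (minusTwo ∷ three    ∷ minusTwo ∷ minusTwo ∷ three    ∷ []) = c14
classify (minusTwo ∷ minusTwo ∷ three    ∷ three    ∷ minusTwo ∷ []) = c23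
classify (minusTwo ∷ minusTwo ∷ three    ∷ minusTwo ∷ three    ∷ []) = c24
classify (minusTwo ∷ minusTwo ∷ minusTwo ∷ three    ∷ three    ∷ []) = c34
classify _                                                          = c01

classify-block : ∀ c → classify (block c zero) ≡ c
classify-block c01 = refl
classify-block c02 = refl
classify-block c03 = refl
classify-block c04 = refl
classify-block c12 = refl
classify-block c13 = refl
classify-block c14 = refl
classify-block c23 = refl
classify-block c24 = refl
classify-block c34 = refl

block-classify : ∀ a₀ a₁ a₂ a₃ a₄ → let b = a₀ ∷ a₁ ∷ a₂ ∷ a₃ ∷ a₄ ∷ [] in wsum b ≡ + 0 → block (classify b) zero ≡ b
block-classify three    three    three    three    three    ()
block-classify three    three    three    three    minusTwo ()
block-classify three    three    three    minusTwo three    ()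
block-classify three    three    three    minusTwo minusTwo ()
block-classify three    three    minusTwo three    three    ()
block-classify three    three    minusTwo three    minusTwo ()
block-classify three    three    minusTwo minusTwo three    ()
block-classify three    three    minusTwo minusTwo minusTwo _  = refl
block-classify three    minusTwo three    three    three    ()
block-classify three    minusTwo three    three    minusTwo ()
block-classify three    minusTwo three    minusTwo three    ()
block-classify three    minusTwo three    minusTwo minusTwo _  = refl
block-classify three    minusTwo minusTwo three    three    ()
block-classify three    minusTwo minusTwo three    minusTwo _  = refl
block-classify three    minusTwo minusTwo minusTwo three    _  = refl
block-classify three    minusTwo minusTwo minusTwo minusTwo ()
block-classify minusTwo three    three    three    three    ()
block-classify minusTwo three    three    three    minusTwo ()
block-classify minusTwo three    three    minusTwo three    ()
block-classify minusTwo three    three    minusTwo minusTwo _  = refl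
block-classify minusTwo three    minusTwo three    three    ()
block-classify minusTwo three    minusTwo three    minusTwo _  = refl
block-classify minusTwo three    minusTwo minusTwo three    _  = refl
block-classify minusTwo three    minusTwo minusTwo minusTwo ()
block-classify minusTwo minusTwo three    three    three    ()
block-classify minusTwo minusTwo three    three    minusTwo _  = refl
block-classify minusTwo minusTwo three    minusTwo three    _  = refl
block-classify minusTwo minusTwo three    minusTwo minusTwo ()
block-classify minusTwo minusTwo minusTwo three    three    _  = refl
block-classify minusTwo minusTwo minusTwo three    minusTwo ()
block-classify minusTwo minusTwo minusTwo minusTwo three    ()
block-classify minusTwo minusTwo minusTwo minusTwo minusTwo ()

rotate : Word → Word
rotate []      = []
rotate (a ∷ w) = w ++ a ∷ []

rotateBy : ℕ → Word → Word
rotateBy zero    w = w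
rotateBy (suc k) w = rotate (rotateBy k w)

wsum-++ : ∀ u w → wsum (u ++ w) ≡ wsum u +ᶻ wsum w
wsum-++ []      w = sym (ℤₚ.+-identityˡ (wsum w))
wsum-++ (a ∷ u) w = trans (cong (val a +ᶻ_) (wsum-++ u w)) (sym (ℤₚ.+-assoc (val a) (wsum u) (wsum w)))

wsum-rotateBy : ∀ k w → wsum (rotateBy k w) ≡ wsum w
wsum-rotateBy zero    w = refl
wsum-rotateBy (suc k) w = trans (wsum-rotate (rotateBy k w)) (wsum-rotateBy k w)
  where
  wsum-rotate : ∀ w → wsum (rotate w) ≡ wsum w
  wsum-rotate []      = refl
  wsum-rotate (a ∷ w) = trans (wsum-++ w (a ∷ [])) (trans (cong (wsum w +ᶻ_) (ℤₚ.+-identityʳ (val a))) (ℤₚ.+-comm (wsum w) (val a)))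

length-rotateBy : ∀ k w → length (rotateBy k w) ≡ length w
length-rotateBy zero    w = refl
length-rotateBy (suc k) w = trans (length-rotate (rotateBy k w)) (length-rotateBy k w)
  where
  length-rotate : ∀ w → length (rotate w) ≡ length w
  length-rotate []      = refl
  length-rotate (a ∷ w) = trans (Listₚ.length-++ w) (ℕₚ.+-comm (length w) 1)

block-rotateBy : ∀ c r → block c r ≡ rotateBy (toℕ r) (block c zero)
block-rotateBy c zero                         = refl
block-rotateBy c (suc zero)                   = refl
block-rotateBy c (suc (suc zero))             = refl
block-rotateBy c (suc (suc (suc zero)))       = refl
block-rotateBy c (suc (suc (suc (suc zero)))) = refl

unrotate : Fin 5 → Word → Word
unrotate r = rotateBy (5 ∸ toℕ r)

unrotate-block : ∀ c r → unrotate r (block c r) ≡ block c zero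
unrotate-block c zero                         = refl
unrotate-block c (suc zero)                   = refl
unrotate-block c (suc (suc zero))             = refl
unrotate-block c (suc (suc (suc zero)))       = refl
unrotate-block c (suc (suc (suc (suc zero)))) = refl

rotateBy-unrotate : ∀ r a₀ a₁ a₂ a₃ a₄ → let b = a₀ ∷ a₁ ∷ a₂ ∷ a₃ ∷ a₄ ∷ [] in rotateBy (toℕ r) (unrotate r b) ≡ b
rotateBy-unrotate zero                         _ _ _ _ _ = refl
rotateBy-unrotate (suc zero)                   _ _ _ _ _ = refl
rotateBy-unrotate (suc (suc zero))             _ _ _ _ _ = refl
rotateBy-unrotate (suc (suc (suc zero)))       _ _ _ _ _ = refl
rotateBy-unrotate (suc (suc (suc (suc zero)))) _ _ _ _ _ = refl

colourOf : Fin 5 → Word → Colour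
colourOf r b = classify (unrotate r b)

colourOf-block : ∀ c r → colourOf r (block c r) ≡ c
colourOf-block c r = trans (cong classify (unrotate-block c r)) (classify-block c)

block-colourOf : ∀ r b → length b ≡ 5 → Balanced b → block (colourOf r b) r ≡ b
block-colourOf r b@(a₀ ∷ a₁ ∷ a₂ ∷ a₃ ∷ a₄ ∷ []) refl b-balanced = begin
  block (classify x) r                          ≡⟨ block-rotateBy (classify x) r ⟩
  rotateBy (toℕ r) (block (classify x) zero)    ≡⟨ cong (rotateBy (toℕ r)) (lemma x (length-rotateBy (5 ∸ toℕ r) b) x-balanced) ⟩
  rotateBy (toℕ r) x                            ≡⟨ rotateBy-unrotate r a₀ a₁ a₂ a₃ a₄ ⟩
  b                                             ∎
  where
  open ≡-Reasoning
  x = unrotate r b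
  x-balanced : wsum x ≡ + 0
  x-balanced = trans (wsum-rotateBy (5 ∸ toℕ r) b) (trans (wsum≡height-length b) b-balanced)
  lemma : ∀ y → length y ≡ 5 → wsum y ≡ + 0 → block (classify y) zero ≡ y
  lemma (y₀ ∷ y₁ ∷ y₂ ∷ y₃ ∷ y₄ ∷ []) refl = block-classify y₀ y₁ y₂ y₃ y₄

-- Minima within a residue class

module LeastWitness {P : ℕ → Set} (P? : ∀ u → Dec (P u)) where

  Least : ℕ → ℕ → Set
  Least N s = s < N × P s × (∀ v → v < s → ¬ P v)

  search : ∀ N → (∃ (Least N)) ⊎ (∀ v → v < N → ¬ P v)
  search zero = inj₂ (λ _ ())
  search (suc N) with search N
  ... | inj₁ (s , s<N , Ps , below) = inj₁ (s , ℕₚ.m<n⇒m<1+n s<N , Ps , below)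
  ... | inj₂ none with P? N
  ...   | yes PN  = inj₁ (N , ℕₚ.n<1+n N , PN , none)
  ...   | no  ¬PN = inj₂ none′
    where
    none′ : ∀ v → v < suc N → ¬ P v
    none′ v v<1+N with ℕₚ.m<1+n⇒m<n∨m≡n v<1+N
    ... | inj₁ v<N  = none v v<N
    ... | inj₂ refl = ¬PN

  Least-unique : ∀ {N s t} → Least N s → Least N t → s ≡ t
  Least-unique {s = s} {t} (_ , Ps , s-least) (_ , Pt , t-least) with ℕₚ.<-cmp s t
  ... | tri< s<t _ _ = ⊥-elim (t-least s s<t Ps)
  ... | tri≈ _ s≡t _ = s≡t
  ... | tri> _ _ t<s = ⊥-elim (s-least t t<s Pt)

  least : ℕ → ℕ
  least N with search N
  ... | inj₁ (s , _) = s
  ... | inj₂ _       = 0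

  least-Least : ∀ N t → t < N → P t → Least N (least N)
  least-Least N t t<N Pt with search N
  ... | inj₁ (_ , s-least) = s-least
  ... | inj₂ none          = ⊥-elim (none t t<N Pt)

  Least⇒least≡ : ∀ {N s} → Least N s → least N ≡ s
  Least⇒least≡ {N} s-least@(s<N , Ps , _) = Least-unique (least-Least N _ s<N Ps) s-least

module EarliestMinimum (f : ℕ → ℤ) where

  private
    IsEarliestMin : ℕ → ℕ → Set
    IsEarliestMin N t = t < N × (∀ u → u < N → f t ≤ᶻ f u) × (∀ u → u < t → f t <ᶻ f u)

    earliestMin : ∀ N → ∃ (IsEarliestMin (suc N))
    earliestMin zero    = 0 , s≤s z≤n , (λ { zero _ → ℤₚ.≤-refl ; (suc _) (s≤s ()) }) , (λ _ ())
    earliestMin (suc N) with earliestMin N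
    ... | t , t<N , t-min , t-earliest with f (suc N) ℤₚ.<? f t
    ...   | yes fN<ft = suc N , ℕₚ.n<1+n (suc N) , N-min , λ u u<N → ℤₚ.<-≤-trans fN<ft (t-min u u<N)
      where
      N-min : ∀ u → u < suc (suc N) → f (suc N) ≤ᶻ f u
      N-min u u<N+2 with ℕₚ.m<1+n⇒m<n∨m≡n u<N+2
      ... | inj₁ u<N+1 = ℤₚ.<⇒≤ (ℤₚ.<-≤-trans fN<ft (t-min u u<N+1))
      ... | inj₂ refl  = ℤₚ.≤-refl
    ...   | no  fN≮ft = t , ℕₚ.m<n⇒m<1+n t<N , t-min′ , t-earliest
      where
      t-min′ : ∀ u → u < suc (suc N) → f t ≤ᶻ f u
      t-min′ u u<N+2 with ℕₚ.m<1+n⇒m<n∨m≡n u<N+2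
      ... | inj₁ u<N+1 = t-min u u<N+1
      ... | inj₂ refl  = ℤₚ.≮⇒≥ fN≮ft

  -- The earliest position below N where f is least (0 when N = 0).
  argmin : ℕ → ℕ
  argmin zero    = zero
  argmin (suc N) = proj₁ (earliestMin N)

  argmin≤ : ∀ N → argmin N ≤ N
  argmin≤ zero    = z≤n
  argmin≤ (suc N) = ℕₚ.<⇒≤ (proj₁ (proj₂ (earliestMin N)))

  argmin-< : ∀ {N} → 0 < N → argmin N < N
  argmin-< {suc N} _ = proj₁ (proj₂ (earliestMin N))

  argmin-min : ∀ N u → u < N → f (argmin N) ≤ᶻ f u
  argmin-min (suc N) = proj₁ (proj₂ (proj₂ (earliestMin N)))

  argmin-earliest : ∀ N u → u < argmin N → f (argmin N) <ᶻ f u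
  argmin-earliest (suc N) = proj₂ (proj₂ (proj₂ (earliestMin N)))

  argmin-unique : ∀ N t → t < N → (∀ u → u < N → f t ≤ᶻ f u) → (∀ u → u < t → f t <ᶻ f u) → argmin N ≡ t
  argmin-unique (suc N) t t<N t-min t-earliest with earliestMin N
  ... | s , s<N , s-min , s-earliest with ℕₚ.<-cmp s t
  ...   | tri< s<t _ _ = ⊥-elim (ℤₚ.<-irrefl refl (ℤₚ.<-≤-trans (t-earliest s s<t) (s-min t t<N)))
  ...   | tri≈ _ s≡t _ = s≡t
  ...   | tri> _ _ t<s = ⊥-elim (ℤₚ.<-irrefl refl (ℤₚ.<-≤-trans (s-earliest t t<s) (t-min s s<N)))

IsPhaseMin : Word → ℕ → Set
IsPhaseMin w t = ∀ {u} → u < length w → phase u ≡ phase t → height w t ≤ᶻ height w u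

isPhaseMin? : ∀ w t → Dec (IsPhaseMin w t)
isPhaseMin? w t = ℕₚ.allUpTo? (λ u → (phase u Finₚ.≟ phase t) →-dec (height w t ℤₚ.≤? height w u)) (length w)

IsPhaseMin-transfer : ∀ w x y → IsPhaseMin w x → height w y ≡ height w x → phase y ≡ phase x → IsPhaseMin w y
IsPhaseMin-transfer w x y x-min y≡x same-phase {u} u<n pu = subst (_≤ᶻ height w u) (sym y≡x) (x-min u<n (trans pu same-phase))

val≤3 : ∀ a → val a ≤ᶻ + 3
val≤3 three    = ℤₚ.≤-refl
val≤3 minusTwo = -≤+

-2≤val : ∀ a → -[1+ 1 ] ≤ᶻ val a
-2≤val three    = -≤+
-2≤val minusTwo = ℤₚ.≤-refl

module PhaseMinima (w : Word) (noBad : NoBadPair w) (balanced : Balanced w) (phase-n : phase (length w) ≡ zero) where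

  private
    N = length w

  FirstPhaseMin : ℕ → Set
  FirstPhaseMin t = ∀ v → v < t → phase v ≡ phase t → ¬ IsPhaseMin w v

  -- A first minimum of its class stays minimal one step later: a strictly higher position of
  -- the same class is at least 5 higher (height-gap), which one step (+3 against -2) cannot
  -- overturn; at equal height only a 3 at t against a -2 at v could, and that is a bad pair
  -- if t < v and contradicts firstness if v < t.
  step-≤ : ∀ t v → t < N → v < N → IsPhaseMin w t → FirstPhaseMin t → phase v ≡ phase t →
           height w (suc t) ≤ᶻ height w (suc v)
  step-≤ t v t<N v<N t-min t-first same-phase =
    subst₂ _≤ᶻ_ (sym (height-suc w t t<N)) (sym (height-suc w v v<N)) (compare (height w t ℤₚ.≟ height w v))
    where
    compare : Dec (height w t ≡ height w v) →
              height w t +ᶻ val (letterAt w t) ≤ᶻ height w v +ᶻ val (letterAt w v)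
    compare (no t≢v) = begin
      height w t +ᶻ val (letterAt w t)       ≤⟨ ℤₚ.+-monoʳ-≤ (height w t) (val≤3 (letterAt w t)) ⟩
      height w t +ᶻ + 3                      ≡⟨ lemma (height w t) ⟩
      height w t +ᶻ + 5 +ᶻ -[1+ 1 ]          ≤⟨ ℤₚ.+-monoˡ-≤ -[1+ 1 ] (height-gap w t v (ℕₚ.<⇒≤ t<N) (ℕₚ.<⇒≤ v<N) (sym same-phase) t<v) ⟩
      height w v +ᶻ -[1+ 1 ]                 ≤⟨ ℤₚ.+-monoʳ-≤ (height w v) (-2≤val (letterAt w v)) ⟩
      height w v +ᶻ val (letterAt w v)       ∎
      where
      open ℤₚ.≤-Reasoning
      t<v = ℤₚ.≤∧≢⇒< (t-min v<N same-phase) t≢v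
      lemma : ∀ h → h +ᶻ + 3 ≡ h +ᶻ + 5 +ᶻ -[1+ 1 ]
      lemma = solve-∀
    compare (yes t≡v) = ℤₚ.+-mono-≤ (ℤₚ.≤-reflexive t≡v) (letters (letterAt w t) refl (letterAt w v) refl)
      where
      letters : ∀ a → letterAt w t ≡ a → ∀ b → letterAt w v ≡ b → val a ≤ᶻ val b
      letters minusTwo _ b _ = -2≤val b
      letters three    _ three _ = ℤₚ.≤-refl
      letters three at-t minusTwo at-v with ℕₚ.<-cmp v t
      ... | tri< v<t _ _ = ⊥-elim (t-first v v<t same-phase (IsPhaseMin-transfer w t v t-min (sym t≡v) same-phase))
      ... | tri≈ _ refl _ with trans (sym at-t) at-v
      ...   | ()
      letters three at-t minusTwo at-v | tri> _ _ t<v = ⊥-elim (noBad t v t<v v<N at-t at-v t≡v)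

  -- Position N behaves like position 0: same phase and, w being balanced, same height.
  IsPhaseMin-suc : ∀ t → t < N → IsPhaseMin w t → FirstPhaseMin t → IsPhaseMin w (suc t)
  IsPhaseMin-suc t t<N t-min t-first {zero} 0<N same-phase =
    subst (height w (suc t) ≤ᶻ_) (trans (cong (height w) v+1≡N) balanced)
          (step-≤ t (pred N) t<N (subst (pred N <_) v+1≡N ℕₚ.≤-refl) t-min t-first
                  (next-injective (trans (trans (cong phase v+1≡N) phase-n) same-phase)))
    where
    v+1≡N : suc (pred N) ≡ N
    v+1≡N = ℕₚ.suc-pred N {{>-nonZero 0<N}}
  IsPhaseMin-suc t t<N t-min t-first {suc v} v+1<N same-phase =
    step-≤ t v t<N (ℕₚ.<-trans (ℕₚ.n<1+n v) v+1<N) t-min t-first (next-injective same-phase)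

  IsPhaseMin-length⇒IsPhaseMin-0 : IsPhaseMin w N → IsPhaseMin w 0
  IsPhaseMin-length⇒IsPhaseMin-0 N-min = IsPhaseMin-transfer w N 0 N-min (sym balanced) (sym phase-n)

  open LeastWitness (isPhaseMin? w) using (Least)

  module FirstWindow (5≤N : 5 ≤ N) (s : ℕ) (s-Least : Least N s) where

    private
      s<N   = proj₁ s-Least
      s-min = proj₁ (proj₂ s-Least)
      s-first : ∀ v → v < s → ¬ IsPhaseMin w v
      s-first = proj₂ (proj₂ s-Least)

      Window : ℕ → Set
      Window j = s + j < N × IsPhaseMin w (s + j) × FirstPhaseMin (s + j)

      s≡0-if-min-at-N : ∀ {x} → IsPhaseMin w x → x ≡ N → s ≡ 0
      s≡0-if-min-at-N x-min refl =
        ℕₚ.n≤0⇒n≡0 (ℕₚ.≮⇒≥ (λ 0<s → s-first 0 0<s (IsPhaseMin-length⇒IsPhaseMin-0 x-min)))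

      window-suc : ∀ j → suc j < 5 → Window j → Window (suc j)
      window-suc j j+1<5 (s+j<N , sj-min , sj-first) = bound , min , first
        where
        min : IsPhaseMin w (s + suc j)
        min = subst (IsPhaseMin w) (sym (ℕₚ.+-suc s j)) (IsPhaseMin-suc (s + j) s+j<N sj-min sj-first)
        bound : s + suc j < N
        bound with ℕₚ.m≤n⇒m<n∨m≡n (subst (_≤ N) (sym (ℕₚ.+-suc s j)) s+j<N)
        ... | inj₁ s+j+1<N = s+j+1<N
        ... | inj₂ s+j+1≡N = ⊥-elim (ℕₚ.<-irrefl refl (ℕₚ.<-≤-trans j+1<5
                               (subst (5 ≤_) (trans (sym s+j+1≡N) (cong (_+ suc j) (s≡0-if-min-at-N min s+j+1≡N))) 5≤N)))
        first : FirstPhaseMin (s + suc j)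
        first v v<s+j+1 same-phase with position s v
        ... | before v<s = s-first v v<s
        ... | after i    = ⊥-elim (ℕₚ.<-irrefl (window-phase-injective s i<5 j+1<5 same-phase) i<j+1)
          where
          i<j+1 = ℕₚ.+-cancelˡ-< s i (suc j) v<s+j+1
          i<5   = ℕₚ.<-trans i<j+1 j+1<5

      window : ∀ j → j < 5 → Window j
      window zero    _     = subst Window′ (sym (ℕₚ.+-identityʳ s)) (s<N , s-min , λ v v<s _ → s-first v v<s)
        where Window′ = λ x → x < N × IsPhaseMin w x × FirstPhaseMin x
      window (suc j) j+1<5 = window-suc j j+1<5 (window j (ℕₚ.<-trans (ℕₚ.n<1+n j) j+1<5))

      window-4 = window 4 ℕₚ.≤-refl

    window-min : ∀ j → j < 5 → IsPhaseMin w (s + j)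
    window-min j j<5 = proj₁ (proj₂ (window j j<5))

    s+5≤N : s + 5 ≤ N
    s+5≤N = subst (_≤ N) (sym (ℕₚ.+-suc s 4)) (proj₁ window-4)

    private
      s+5-min : IsPhaseMin w (s + 5)
      s+5-min = subst (IsPhaseMin w) (sym (ℕₚ.+-suc s 4))
                      (IsPhaseMin-suc (s + 4) (proj₁ window-4) (proj₁ (proj₂ window-4)) (proj₂ (proj₂ window-4)))

    height-s+5 : height w (s + 5) ≡ height w s
    height-s+5 = ℤₚ.≤-antisym (s+5-min s<N (sym (phase-+5 s))) s≤s+5
      where
      s≤s+5 : height w s ≤ᶻ height w (s + 5)
      s≤s+5 with ℕₚ.m≤n⇒m<n∨m≡n s+5≤N
      ... | inj₁ s+5<N = s-min s+5<N (phase-+5 s)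
      ... | inj₂ s+5≡N = subst (height w s ≤ᶻ_) (sym (trans (cong (height w) s+5≡N) balanced))
                               (s-min (ℕₚ.<-≤-trans (s≤s z≤n) 5≤N) (sym (trans (trans (sym (phase-+5 s)) (cong phase s+5≡N)) phase-n)))

    s+5<N : 0 < s → s + 5 < N
    s+5<N 0<s with ℕₚ.m≤n⇒m<n∨m≡n s+5≤N
    ... | inj₁ s+5<N = s+5<N
    ... | inj₂ s+5≡N = ⊥-elim (ℕₚ.<-irrefl (sym (s≡0-if-min-at-N s+5-min s+5≡N)) 0<s)

-- Inserting and removing a coloured block

relativeHeight : Colour → Word → ℕ → ℤ
relativeHeight c w t = height w t -ᶻ periodicHeight c t

relativeHeight-suc : ∀ c w t → t < length w →
  relativeHeight c w (suc t) ≡ relativeHeight c w t +ᶻ (val (letterAt w t) -ᶻ val (colourLetter c (phase t)))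
relativeHeight-suc c w t t<n =
  trans (cong₂ _-ᶻ_ (height-suc w t t<n) (periodicHeight-suc c t)) (lemma (height w t) _ (periodicHeight c t) _)
  where
  lemma : ∀ h a p b → h +ᶻ a -ᶻ (p +ᶻ b) ≡ h -ᶻ p +ᶻ (a -ᶻ b)
  lemma = solve-∀

module _ (c : Colour) (w : Word) (x y : ℕ) (same-phase : phase x ≡ phase y) where

  private
    Px≡Py : periodicHeight c x ≡ periodicHeight c y
    Px≡Py = periodicHeight-phase c {x} {y} same-phase

  relativeHeight-≤⇒height-≤ : relativeHeight c w x ≤ᶻ relativeHeight c w y → height w x ≤ᶻ height w y
  relativeHeight-≤⇒height-≤ rx≤ry =
    subst₂ _≤ᶻ_ (cancel (height w x) (periodicHeight c x)) (cancel (height w y) (periodicHeight c y))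
                (ℤₚ.+-mono-≤ rx≤ry (ℤₚ.≤-reflexive Px≡Py))
    where
    cancel : ∀ h p → h -ᶻ p +ᶻ p ≡ h
    cancel = solve-∀

  height-≤⇒relativeHeight-≤ : height w x ≤ᶻ height w y → relativeHeight c w x ≤ᶻ relativeHeight c w y
  height-≤⇒relativeHeight-≤ hx≤hy = ℤₚ.+-mono-≤ hx≤hy (ℤₚ.≤-reflexive (cong -ᶻ_ Px≡Py))

  height-≡⇒relativeHeight-≡ : height w x ≡ height w y → relativeHeight c w x ≡ relativeHeight c w y
  height-≡⇒relativeHeight-≡ hx≡hy = cong₂ _-ᶻ_ hx≡hy Px≡Py

module ColouredSplice (c : Colour) (w : Word) (s : ℕ) (s≤n : s ≤ length w) where

  open Splice s (blockAt c s) w s≤n refl public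

  δ δ′ : ℕ → ℤ
  δ  = relativeHeight c w
  δ′ = relativeHeight c w′

  δ′-shift : ∀ u → δ′ (shift s u) ≡ δ u
  δ′-shift u = cong₂ _-ᶻ_ (height-shift (blockAt-balanced c s) u) (periodicHeight-phase c {shift s u} {u} (phase-shift s u))

  δ′-window : ∀ j → j ≤ 5 → δ′ (s + j) ≡ δ s
  δ′-window j j≤5 = begin
    height w′ (s + j) -ᶻ P (s + j)                           ≡⟨ cong (_-ᶻ P (s + j)) (height-window j j≤5) ⟩
    height w s +ᶻ height (blockAt c s) j -ᶻ P (s + j)        ≡⟨ cong (λ h → height w s +ᶻ h -ᶻ P (s + j)) (height-blockAt c s j j≤5) ⟩
    height w s +ᶻ (P (s + j) -ᶻ P s) -ᶻ P (s + j)            ≡⟨ lemma (height w s) (P (s + j)) (P s) ⟩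
    height w s -ᶻ P s                                        ∎
    where
    open ≡-Reasoning
    P = periodicHeight c
    lemma : ∀ h a b → h +ᶻ (a -ᶻ b) -ᶻ a ≡ h -ᶻ b
    lemma = solve-∀

  δ′-min : (∀ u → u < length w → δ s ≤ᶻ δ u) → ∀ v → v < length w′ → δ s ≤ᶻ δ′ v
  δ′-min δs-min v v<n′ with old-or-new v v<n′
  ... | inj₁ (u , u<n , refl)  = subst (δ s ≤ᶻ_) (sym (δ′-shift u)) (δs-min u u<n)
  ... | inj₂ (j , j<5 , refl) = ℤₚ.≤-reflexive (sym (δ′-window j (ℕₚ.<⇒≤ j<5)))

  IsPhaseMin-window : (∀ u → u < length w → δ s ≤ᶻ δ u) → ∀ j → j < 5 → IsPhaseMin w′ (s + j)
  IsPhaseMin-window δs-min j j<5 {v} v<n′ same-phase =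
    relativeHeight-≤⇒height-≤ c w′ (s + j) v (sym same-phase)
      (subst (_≤ᶻ δ′ v) (sym (δ′-window j (ℕₚ.<⇒≤ j<5))) (δ′-min δs-min v v<n′))

  δ-≤-if-IsPhaseMin : ∀ u → u < s → IsPhaseMin w′ u → δ u ≤ᶻ δ s
  δ-≤-if-IsPhaseMin u u<s u-min =
    let j , j<5 , same-phase = window-phase-cover s u in
    subst₂ _≤ᶻ_ (trans (cong δ′ (sym (shift-< u<s))) (δ′-shift u)) (δ′-window j (ℕₚ.<⇒≤ j<5))
      (height-≤⇒relativeHeight-≤ c w′ u (s + j) (sym same-phase) (u-min (window-<-length j j<5) same-phase))

insertionPoint : Colour → Word → ℕ
insertionPoint c w = EarliestMinimum.argmin (relativeHeight c w) (length w)

insertBlock : Colour → Word → Word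
insertBlock c w = insertAt (insertionPoint c w) (blockAt c (insertionPoint c w)) w

firstPhaseMin : Word → ℕ
firstPhaseMin w = LeastWitness.least (isPhaseMin? w) (length w)

removeBlock : Word → Word
removeBlock w = removeWindowAt (firstPhaseMin w) w

removedColour : Word → Colour
removedColour w = colourOf (phase (firstPhaseMin w)) (windowAt (firstPhaseMin w) w)

module Insertion (c : Colour) (w : Word) (noBad : NoBadPair w) (balanced : Balanced w)
                 (phase-n : phase (length w) ≡ zero) where

  open EarliestMinimum (relativeHeight c w)

  t : ℕ
  t = insertionPoint c w

  open ColouredSplice c w t (argmin≤ (length w)) public

  private
    N = length w
    t≤N = argmin≤ N
    δt-min      = argmin-min N
    δt-earliest = argmin-earliest N

    -- δ takes the same value at N as at 0.
    δt-≤-δ-suc : ∀ u → u < N → δ t ≤ᶻ δ (suc u)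
    δt-≤-δ-suc u u<N with ℕₚ.m≤n⇒m<n∨m≡n u<N
    ... | inj₁ u+1<N = δt-min (suc u) u+1<N
    ... | inj₂ u+1≡N = subst (δ t ≤ᶻ_) (sym δ-u+1≡δ-0) (δt-min 0 (ℕₚ.<-≤-trans (s≤s z≤n) u<N))
      where
      δ-u+1≡δ-0 : δ (suc u) ≡ δ 0
      δ-u+1≡δ-0 = cong₂ _-ᶻ_ (trans (cong (height w) u+1≡N) balanced)
                            (periodicHeight-phase c {suc u} {0} (trans (cong phase u+1≡N) phase-n))

    letterAt-new : ∀ j → j < 5 → letterAt w′ (t + j) ≡ colourLetter c (phase (t + j))
    letterAt-new j j<5 = trans (letterAt-window j j<5) (letterAt-blockAt c t j j<5)

    same-height⇒same-phase : ∀ {p q} → p < q → q < length w′ → height w′ p ≡ height w′ q → phase p ≡ phase q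
    same-height⇒same-phase p<q q<n′ = height≡⇒phase≡ w′ _ _ (ℕₚ.<⇒≤ (ℕₚ.<-trans p<q q<n′)) (ℕₚ.<⇒≤ q<n′)

    old≡new⇒δ≡δt : ∀ u j → j ≤ 5 → phase (shift t u) ≡ phase (t + j) → height w′ (shift t u) ≡ height w′ (t + j) → δ u ≡ δ t
    old≡new⇒δ≡δt u j j≤5 same-phase same =
      trans (sym (δ′-shift u)) (trans (height-≡⇒relativeHeight-≡ c w′ (shift t u) (t + j) same-phase same) (δ′-window j j≤5))

    a+-5<a : ∀ a → a +ᶻ -[1+ 4 ] <ᶻ a
    a+-5<a a = ℤₚ.<-≤-trans (ℤₚ.+-monoʳ-< a -<+) (ℤₚ.≤-reflexive (ℤₚ.+-identityʳ a))

  noBad′ : NoBadPair w′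
  noBad′ p q p<q q<n′ at-p at-q same with old-or-new p (ℕₚ.<-trans p<q q<n′) | old-or-new q q<n′
  ... | inj₁ (u₁ , u₁<n , refl) | inj₁ (u₂ , u₂<n , refl) =
    noBad u₁ u₂ (shift-cancel-< t p<q) u₂<n (trans (sym (letterAt-shift u₁)) at-p) (trans (sym (letterAt-shift u₂)) at-q)
          (trans (sym (height-shift (blockAt-balanced c t) u₁)) (trans same (height-shift (blockAt-balanced c t) u₂)))
  ... | inj₂ (i , i<5 , refl) | inj₂ (j , j<5 , refl) =
    ℕₚ.<-irrefl (cong (λ n → t + n) (window-phase-injective t i<5 j<5 (same-height⇒same-phase p<q q<n′ same))) p<q
  ... | inj₁ (u , u<n , refl) | inj₂ (j , j<5 , refl) =
    ℤₚ.<-irrefl (sym (old≡new⇒δ≡δt u j (ℕₚ.<⇒≤ j<5) (same-height⇒same-phase p<q q<n′ same) same))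
                (δt-earliest u (shift-<-window⇒< u j p<q j<5))
  ... | inj₂ (i , i<5 , refl) | inj₁ (u , u<n , refl) =
    ℤₚ.<-irrefl refl (ℤₚ.≤-<-trans (subst (δ t ≤ᶻ_) δ-u+1≡δt-5 (δt-≤-δ-suc u u<n)) (a+-5<a (δ t)))
    where
    same-phase = same-height⇒same-phase p<q q<n′ same
    -- w descends by 2 at u while the periodic word climbs by 3 there.
    δ-u+1≡δt-5 : δ (suc u) ≡ δ t +ᶻ -[1+ 4 ]
    δ-u+1≡δt-5 = trans (relativeHeight-suc c w u u<n) (cong₂ (λ d (x : ℤ) → d +ᶻ x)
      (old≡new⇒δ≡δt u i (ℕₚ.<⇒≤ i<5) (sym same-phase) (sym same))
      (cong₂ (λ a b → val a -ᶻ val b)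
             (trans (sym (letterAt-shift u)) at-q)
             (trans (cong (colourLetter c) (sym (trans same-phase (phase-shift t u)))) (trans (sym (letterAt-new i i<5)) at-p))))

  balanced′ : Balanced w′
  balanced′ = begin
    height w′ (length w′)           ≡⟨ cong (height w′) (trans length-w′ (trans (cong (λ n → 5 + n) (sym (ℕₚ.m+[n∸m]≡n t≤N))) (+-middle-5 t (N ∸ t)))) ⟩
    height w′ (t + (5 + (N ∸ t)))   ≡⟨ height-after (blockAt-balanced c t) (N ∸ t) ⟩
    height w (t + (N ∸ t))          ≡⟨ cong (height w) (ℕₚ.m+[n∸m]≡n t≤N) ⟩
    height w N                      ≡⟨ balanced ⟩
    + 0                             ∎
    where open ≡-Reasoning

  private
    t-Least : LeastWitness.Least (isPhaseMin? w′) (length w′) t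
    t-Least = subst (_< length w′) (ℕₚ.+-identityʳ t) (window-<-length 0 (s≤s z≤n)) ,
              subst (IsPhaseMin w′) (ℕₚ.+-identityʳ t) (IsPhaseMin-window δt-min 0 (s≤s z≤n)) ,
              λ v v<t v-min → ℤₚ.<-irrefl refl (ℤₚ.<-≤-trans (δt-earliest v v<t) (δ-≤-if-IsPhaseMin v v<t v-min))

    firstPhaseMin≡t : firstPhaseMin w′ ≡ t
    firstPhaseMin≡t = LeastWitness.Least⇒least≡ (isPhaseMin? w′) t-Least

  removeBlock-insertBlock : removeBlock w′ ≡ w
  removeBlock-insertBlock =
    trans (cong (λ x → removeWindowAt x w′) firstPhaseMin≡t) (removeWindowAt-insertAt t (blockAt c t) w t≤N refl)

  removedColour-insertBlock : removedColour w′ ≡ c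
  removedColour-insertBlock = begin
    colourOf (phase (firstPhaseMin w′)) (windowAt (firstPhaseMin w′) w′) ≡⟨ cong (λ x → colourOf (phase x) (windowAt x w′)) firstPhaseMin≡t ⟩
    colourOf (phase t) (windowAt t w′)                                   ≡⟨ cong (colourOf (phase t)) (windowAt-insertAt t (blockAt c t) w t≤N refl) ⟩
    colourOf (phase t) (blockAt c t)                                     ≡⟨ colourOf-block c (phase t) ⟩
    c                                                                    ∎
    where open ≡-Reasoning

module Removal (w′ : Word) (noBad′ : NoBadPair w′) (balanced′ : Balanced w′)
               (phase-n′ : phase (length w′) ≡ zero) (5≤n′ : 5 ≤ length w′) where

  open PhaseMinima w′ noBad′ balanced′ phase-n′
  open LeastWitness (isPhaseMin? w′)

  private
    N′ = length w′

  s : ℕ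
  s = firstPhaseMin w′

  private
    -- A lowest position overall is a minimum of its class, so some phase minimum exists.
    s-Least : Least N′ s
    s-Least = least-Least N′ lowest lowest<N′ lowest-min
      where
      open EarliestMinimum (height w′)
      lowest = argmin N′
      lowest<N′ : lowest < N′
      lowest<N′ = argmin-< (ℕₚ.<-≤-trans (s≤s z≤n) 5≤n′)
      lowest-min : IsPhaseMin w′ lowest
      lowest-min u<N′ _ = argmin-min N′ _ u<N′

  open FirstWindow 5≤n′ s s-Least

  b : Word
  b = windowAt s w′

  w : Word
  w = removeWindowAt s w′

  c : Colour
  c = colourOf (phase s) b

  private
    k = N′ ∸ (s + 5)
    s≤N′ = ℕₚ.<⇒≤ (proj₁ s-Least)

    s+[5+k]≡N′ : s + (5 + k) ≡ N′
    s+[5+k]≡N′ = trans (sym (ℕₚ.+-assoc s 5 k)) (ℕₚ.m+[n∸m]≡n s+5≤N)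

    |b|≡5 : length b ≡ 5
    |b|≡5 = trans (Listₚ.length-take 5 (drop s w′)) (ℕₚ.m≤n⇒m⊓n≡m (subst (5 ≤_) (sym (Listₚ.length-drop s w′)) 5≤N′∸s))
      where
      5≤N′∸s : 5 ≤ N′ ∸ s
      5≤N′∸s = subst (λ n → 5 ≤ n ∸ s) s+[5+k]≡N′ (subst (5 ≤_) (sym (ℕₚ.m+n∸m≡n s (5 + k))) (ℕₚ.m≤m+n 5 k))

    b-balanced : Balanced b
    b-balanced = +ᶻ-cancelˡ-≡ (height w′ s) _ _ (begin
      height w′ s +ᶻ height b (length b)  ≡⟨ cong (λ n → height w′ s +ᶻ height b n) |b|≡5 ⟩
      height w′ s +ᶻ height b 5           ≡⟨ cong (height w′ s +ᶻ_) (height-take 5 (drop s w′) 5 ℕₚ.≤-refl) ⟩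
      height w′ s +ᶻ height (drop s w′) 5 ≡⟨ height-drop s w′ 5 s≤N′ ⟨
      height w′ (s + 5)                   ≡⟨ height-s+5 ⟩
      height w′ s                         ≡⟨ ℤₚ.+-identityʳ (height w′ s) ⟨
      height w′ s +ᶻ + 0                  ∎)
      where open ≡-Reasoning

  length-w : length w ≡ s + k
  length-w = trans (Listₚ.length-++ (take s w′))
                   (cong₂ _+_ (length-take≤ s w′ s≤N′)
                              (trans (Listₚ.length-drop (5 + s) w′) (cong (_∸ (5 + s)) (sym 5+s+k≡N′)) ∙ ℕₚ.m+n∸m≡n (5 + s) k))
    where
    _∙_ = trans
    5+s+k≡N′ : 5 + s + k ≡ N′
    5+s+k≡N′ = trans (cong (_+ k) (ℕₚ.+-comm 5 s)) (ℕₚ.m+[n∸m]≡n s+5≤N)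

  private
    s≤n : s ≤ length w
    s≤n = subst (s ≤_) (sym length-w) (ℕₚ.m≤m+n s k)

    blockAt≡b : blockAt c s ≡ b
    blockAt≡b = block-colourOf (phase s) b |b|≡5 b-balanced

  insertAt-b-w≡w′ : insertAt s (blockAt c s) w ≡ w′
  insertAt-b-w≡w′ = trans (cong (λ x → insertAt s x w) blockAt≡b) (insertAt-removeWindowAt s w′ s≤N′)

  open ColouredSplice c w s s≤n renaming (w′ to w″; length-w′ to length-w″)

  private
    w″≡w′ : w″ ≡ w′
    w″≡w′ = insertAt-b-w≡w′

  noBad : NoBadPair w
  noBad = NoBadPair-remove (blockAt-balanced c s) (subst NoBadPair (sym w″≡w′) noBad′)

  balanced : Balanced w
  balanced = begin
    height w (length w)           ≡⟨ cong (height w) length-w ⟩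
    height w (s + k)              ≡⟨ height-after (blockAt-balanced c s) k ⟨
    height w″ (s + (5 + k))       ≡⟨ cong (λ x → height x (s + (5 + k))) w″≡w′ ⟩
    height w′ (s + (5 + k))       ≡⟨ cong (height w′) s+[5+k]≡N′ ⟩
    height w′ N′                  ≡⟨ balanced′ ⟩
    + 0                           ∎
    where open ≡-Reasoning

  phase-n : phase (length w) ≡ zero
  phase-n = phase-+-cancelˡ 5 {length w} {0} (begin
    phase (5 + length w)    ≡⟨ cong (λ n → phase (5 + n)) length-w ⟩
    phase (5 + (s + k))     ≡⟨ cong phase (+-middle-5 s k) ⟩
    phase (s + (5 + k))     ≡⟨ cong phase s+[5+k]≡N′ ⟩
    phase N′                ≡⟨ phase-n′ ⟩
    zero                    ≡⟨ phase-5+ 0 ⟨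
    phase (5 + 0)           ∎)
    where open ≡-Reasoning

  private
    δs-min : ∀ u → u < length w → δ s ≤ᶻ δ u
    δs-min u u<n =
      let j , j<5 , same-phase = window-phase-cover s u in
      subst₂ _≤ᶻ_ (δ′-window j (ℕₚ.<⇒≤ j<5)) (δ′-shift u)
        (height-≤⇒relativeHeight-≤ c w″ (s + j) (shift s u) (trans same-phase (sym (phase-shift s u)))
          (subst (λ x → height x (s + j) ≤ᶻ height x (shift s u)) (sym w″≡w′)
            (window-min j j<5 (subst (λ x → shift s u < length x) w″≡w′ (shift-<-length u u<n))
                               (trans (phase-shift s u) (sym same-phase)))))

    δs-earliest : ∀ u → u < s → δ s <ᶻ δ u
    δs-earliest u u<s with δ s ℤₚ.<? δ u
    ... | yes δs<δu = δs<δu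
    ... | no  δs≮δu = ⊥-elim (proj₂ (proj₂ s-Least) u u<s (subst (λ x → IsPhaseMin x u) w″≡w′ u-min))
      where
      u-min : IsPhaseMin w″ u
      u-min {v} v<n″ same-phase =
        relativeHeight-≤⇒height-≤ c w″ u v (sym same-phase)
          (ℤₚ.≤-trans (ℤₚ.≤-trans (ℤₚ.≤-reflexive (trans (cong δ′ (sym (shift-< u<s))) (δ′-shift u))) (ℤₚ.≮⇒≥ δs≮δu))
                      (δ′-min δs-min v v<n″))

    s<n : 0 < length w → s < length w
    s<n 0<n with s ≟ 0
    ... | yes s≡0 = subst (_< length w) (sym s≡0) 0<n
    ... | no  s≢0 = subst (s <_) (sym length-w) (ℕₚ.m<m+n s 0<k)
      where
      0<k : 0 < k
      0<k = ℕₚ.+-cancelˡ-< (s + 5) 0 k (subst₂ _<_ (sym (ℕₚ.+-identityʳ (s + 5))) (trans (sym s+[5+k]≡N′) (sym (ℕₚ.+-assoc s 5 k)))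
                                                (s+5<N (ℕₚ.n≢0⇒n>0 s≢0)))

  insertionPoint≡s : insertionPoint c w ≡ s
  insertionPoint≡s with length w ≟ 0
  ... | yes |w|≡0 = trans (cong (EarliestMinimum.argmin δ) |w|≡0) (sym (ℕₚ.n≤0⇒n≡0 (subst (s ≤_) |w|≡0 s≤n)))
  ... | no  |w|≢0 = EarliestMinimum.argmin-unique δ (length w) s (s<n (ℕₚ.n≢0⇒n>0 |w|≢0)) δs-min δs-earliest

  insertBlock-removeBlock : insertBlock c w ≡ w′
  insertBlock-removeBlock = trans (cong (λ x → insertAt x (blockAt c x) w) insertionPoint≡s) insertAt-b-w≡w′

  length-removeBlock : 5 + length w ≡ N′
  length-removeBlock = trans (sym length-w″) (cong length w″≡w′)

-- Counting

withLength : ∀ {m} (w : Word) → .(length w ≡ m) → Vec Letter m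
withLength w |w|≡m = Vec.cast |w|≡m (Vec.fromList w)

toList-withLength : ∀ {m} w .(|w|≡m : length w ≡ m) → Vec.toList (withLength w |w|≡m) ≡ w
toList-withLength w |w|≡m = trans (Vecₚ.toList-cast |w|≡m (Vec.fromList w)) (Vecₚ.toList∘fromList w)

toList-injective : ∀ {m} (u v : Vec Letter m) → Vec.toList u ≡ Vec.toList v → u ≡ v
toList-injective u v eq = trans (sym (Vecₚ.cast-is-id refl u)) (Vecₚ.toList-injective refl u v eq)

Good-recompute : ∀ w → Recomputable (Good w)
Good-recompute w = Dec.recompute (wsum w ℤₚ.≟ + 0) ×-recompute ¬-recompute

phase-length : ∀ n (v : Vec Letter (5 * n)) → phase (length (Vec.toList v)) ≡ zero
phase-length n v = trans (cong phase (Vecₚ.length-toList v)) (phase-5* n)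

module Step (n : ℕ) where

  private
    5≤length : ∀ (v : Vec Letter (5 * suc n)) → 5 ≤ length (Vec.toList v)
    5≤length v = subst (5 ≤_) (sym (trans (Vecₚ.length-toList v) (ℕₚ.*-suc 5 n))) (ℕₚ.m≤m+n 5 (5 * n))

    module R (v : Vec Letter (5 * suc n)) .(good : Good (Vec.toList v)) =
      Removal (Vec.toList v) (Good⇒NoBadPair _ (Good-recompute _ good)) (Good⇒Balanced _ (Good-recompute _ good)) (phase-length (suc n) v) (5≤length v)

    module I (c : Colour) (v : Vec Letter (5 * n)) .(good : Good (Vec.toList v)) =
      Insertion c (Vec.toList v) (Good⇒NoBadPair _ (Good-recompute _ good)) (Good⇒Balanced _ (Good-recompute _ good)) (phase-length n v)

    length-removeBlock : ∀ v .(good : Good (Vec.toList v)) → length (removeBlock (Vec.toList v)) ≡ 5 * n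
    length-removeBlock v good =
      ℕₚ.+-cancelˡ-≡ 5 _ _ (trans (R.length-removeBlock v good) (trans (Vecₚ.length-toList v) (ℕₚ.*-suc 5 n)))

    length-insertBlock : ∀ c v .(good : Good (Vec.toList v)) → length (insertBlock c (Vec.toList v)) ≡ 5 * suc n
    length-insertBlock c v good =
      trans (I.length-w′ c v good) (trans (cong (λ m → 5 + m) (Vecₚ.length-toList v)) (sym (ℕₚ.*-suc 5 n)))

  remove : GoodWords (5 * suc n) → Colour × GoodWords (5 * n)
  remove (v , [ good ]) =
    removedColour (Vec.toList v) ,
    (withLength (removeBlock (Vec.toList v)) (length-removeBlock v good) ,
     [ subst Good (sym (toList-withLength _ (length-removeBlock v good)))
             (NoBadPair∧Balanced⇒Good _ (R.noBad v good) (R.balanced v good)) ])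

  insert : Colour × GoodWords (5 * n) → GoodWords (5 * suc n)
  insert (c , (v , [ good ])) =
    withLength (insertBlock c (Vec.toList v)) (length-insertBlock c v good) ,
    [ subst Good (sym (toList-withLength _ (length-insertBlock c v good)))
            (NoBadPair∧Balanced⇒Good _ (I.noBad′ c v good) (I.balanced′ c v good)) ]

  remove-insert : ∀ x → remove (insert x) ≡ x
  remove-insert (c , (v , [ good ])) = cong₂ _,_
    (trans (cong removedColour w′≡) (I.removedColour-insertBlock c v good))
    (value-injective (toList-injective _ v
      (trans (toList-withLength _ _) (trans (cong removeBlock w′≡) (I.removeBlock-insertBlock c v good)))))
    where
    w′≡ = toList-withLength (insertBlock c (Vec.toList v)) (length-insertBlock c v good)

  insert-remove : ∀ x → insert (remove x) ≡ x
  insert-remove (v , [ good ]) = value-injective (toList-injective _ v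
    (trans (toList-withLength _ _)
           (trans (cong (insertBlock (removedColour (Vec.toList v))) (toList-withLength _ (length-removeBlock v good)))
                  (R.insertBlock-removeBlock v good))))

  remove↔ : GoodWords (5 * suc n) ↔ (Colour × GoodWords (5 * n))
  remove↔ = mk↔ₛ′ remove insert remove-insert insert-remove

Colour↔Fin10 : Colour ↔ Fin 10
Colour↔Fin10 = mk↔ₛ′ toFin fromFin toFin-fromFin fromFin-toFin
  where
  toFin : Colour → Fin 10
  toFin c01 = # 0
  toFin c02 = # 1
  toFin c03 = # 2
  toFin c04 = # 3
  toFin c12 = # 4
  toFin c13 = # 5
  toFin c14 = # 6
  toFin c23 = # 7
  toFin c24 = # 8
  toFin c34 = # 9
  fromFin : Fin 10 → Colour
  fromFin i = Vec.lookup (c01 ∷ c02 ∷ c03 ∷ c04 ∷ c12 ∷ c13 ∷ c14 ∷ c23 ∷ c24 ∷ c34 ∷ []) i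
  toFin-fromFin : ∀ i → toFin (fromFin i) ≡ i
  toFin-fromFin zero                                                          = refl
  toFin-fromFin (suc zero)                                                    = refl
  toFin-fromFin (suc (suc zero))                                              = refl
  toFin-fromFin (suc (suc (suc zero)))                                        = refl
  toFin-fromFin (suc (suc (suc (suc zero))))                                  = refl
  toFin-fromFin (suc (suc (suc (suc (suc zero)))))                            = refl
  toFin-fromFin (suc (suc (suc (suc (suc (suc zero))))))                      = refl
  toFin-fromFin (suc (suc (suc (suc (suc (suc (suc zero)))))))                = refl
  toFin-fromFin (suc (suc (suc (suc (suc (suc (suc (suc zero))))))))          = refl
  toFin-fromFin (suc (suc (suc (suc (suc (suc (suc (suc (suc zero))))))))) = refl
  fromFin-toFin : ∀ c → fromFin (toFin c) ≡ c
  fromFin-toFin c01 = refl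
  fromFin-toFin c02 = refl
  fromFin-toFin c03 = refl
  fromFin-toFin c04 = refl
  fromFin-toFin c12 = refl
  fromFin-toFin c13 = refl
  fromFin-toFin c14 = refl
  fromFin-toFin c23 = refl
  fromFin-toFin c24 = refl
  fromFin-toFin c34 = refl

GoodWords-0↔Fin1 : GoodWords 0 ↔ Fin 1
GoodWords-0↔Fin1 = mk↔ₛ′ (λ _ → zero) (λ _ → [] , [ refl , NoBadPair⇒¬Bad [] (λ _ _ _ ()) ])
                         (λ { zero → refl }) (λ { ([] , _) → value-injective refl })

mainTheorem1 : (n : ℕ) → GoodWords (5 * n) ↔ Fin (10 ^ n)
mainTheorem1 zero    = GoodWords-0↔Fin1
mainTheorem1 (suc n) = ↔-trans (Step.remove↔ n) (↔-trans (Colour↔Fin10 ×-↔ mainTheorem1 n) (↔-sym Finₚ.*↔×))
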